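{- Let $G$ be a finite tree, let $L$ be its set of leaves and $S$ its set of stems. Then $G\in\Omega$ if and only if the graph $G-(L\cup S)$ is empty or each of its connected components is either a star $K_{1,m}$ ($m\ge 1$) whose center, when $m\ge 2$, has degree exactly $m$ in $G$, or an isolated vertex.
   Context: A leaf is a vertex of degree one; a stem is a vertex having at least one leaf as a neighbor. $G-X$ denotes the graph obtained from $G$ by deleting the vertices of $X$ and all incident edges. A star is a graph isomorphic to $K_{1,n}$ for some $n\ge 1$; for $n\ge2$ its center is the vertex of degree $n$. A star-factor of $G$ is a spanning subgraph each of whose connected components is a star. An edge-weighting of $G$ is a function $w:E(G)\to\mathbb{N}^+$ (positive integers), and the weight of a subgraph $H$ is $w(H)=\sum_{e\in E(H)}w(e)$. $\Omega$ denotes the family of all graphs $G$ for which there exists an edge-weighting $w$ of $G$ such that all star-factors of $G$ have the same weight under $w$. -}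

module Defs where

open import Data.Nat using (ℕ; zero; suc; _+_; _≤_; _<_)
open import Data.Fin using (Fin; zero; suc; inject₁; fromℕ; _<?_)
open import Data.Bool using (Bool; true; false; if_then_else_)
open import Data.List using (List; map; allFin)
open import Data.Nat.ListAction using (sum)
open import Data.Product using (Σ; ∃; _×_; _,_)
open import Data.Sum using (_⊎_)
open import Relation.Nullary using (¬_; does)
open import Relation.Binary.PropositionalEquality using (_≡_; _≢_)
open import Function.Definitions using (Injective)
open import Function.Bundles using (_⇔_)

record Graph (n : ℕ) : Set where
  field
    adj   : Fin n → Fin n → Bool
    sym   : ∀ u v → adj u v ≡ adj v u
    irrfl : ∀ v → adj v v ≡ false
open Graph public

Edge : ∀ {n} → Graph n → Fin n → Fin n → Set
Edge G u v = adj G u v ≡ true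

deg : ∀ {n} → Graph n → Fin n → ℕ
deg {n} G v = sum (map (λ u → if adj G v u then 1 else 0) (allFin n))

data Reach {n : ℕ} (E : Fin n → Fin n → Set) : Fin n → Fin n → Set where
  here : ∀ {v} → Reach E v v
  step : ∀ {u v w} → E u v → Reach E v w → Reach E u w

Connected : ∀ {n} → Graph n → Set
Connected G = ∀ u v → Reach (Edge G) u v

HasCycle : ∀ {n} → Graph n → Set
HasCycle {n} G =
  Σ ℕ λ k → Σ (Fin (suc (suc (suc k))) → Fin n) λ f →
    Injective _≡_ _≡_ f ×
    (∀ (i : Fin (suc (suc k))) → Edge G (f (inject₁ i)) (f (suc i))) ×
    Edge G (f (fromℕ (suc (suc k)))) (f zero)

IsTree : ∀ {n} → Graph n → Set
IsTree {n} G = 0 < n × Connected G × ¬ HasCycle G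

-- Vertices of the graph with edge relation E restricted to the vertex set P
-- form a copy of the star K_{1,m} (center f zero; m = 0 is an isolated vertex):
-- f is a bijection from Fin (1+m) onto P which is an isomorphism onto K_{1,m}.
IsStarK1 : ∀ {n} → (Fin n → Fin n → Set) → (Fin n → Set) → (m : ℕ) →
           (Fin (suc m) → Fin n) → Set
IsStarK1 {n} E P m f =
  Injective _≡_ _≡_ f ×
  (∀ i → P (f i)) ×
  (∀ v → P v → ∃ λ i → f i ≡ v) ×
  (∀ i j → E (f i) (f j) ⇔ ((i ≡ zero × j ≢ zero) ⊎ (j ≡ zero × i ≢ zero)))

Subgraph : ∀ {n} → Graph n → Graph n → Set
Subgraph {n} H G = ∀ (u v : Fin n) → Edge H u v → Edge G u v

IsStarFactor : ∀ {n} → Graph n → Graph n → Set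
IsStarFactor {n} G H =
  Subgraph H G ×
  (∀ (v : Fin n) → Σ ℕ λ m → Σ (Fin (suc m) → Fin n) λ f →
      1 ≤ m × IsStarK1 (Edge H) (Reach (Edge H) v) m f)

-- Edge-weightings: w u v is the weight of edge {u,v}, read for u < v only.
Weighting : ℕ → Set
Weighting n = Fin n → Fin n → ℕ

PositiveWeighting : ∀ {n} → Graph n → Weighting n → Set
PositiveWeighting {n} G w = ∀ (u v : Fin n) → Edge G u v → 1 ≤ w u v

weight : ∀ {n} → Weighting n → Graph n → ℕ
weight {n} w H =
  sum (map (λ u → sum (map (λ v →
     if adj H u v then (if does (u <? v) then w u v else 0) else 0)
     (allFin n))) (allFin n))

InΩ : ∀ {n} → Graph n → Set
InΩ {n} G = Σ (Weighting n) λ w → PositiveWeighting G w ×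
  (∀ (H₁ H₂ : Graph n) → IsStarFactor G H₁ → IsStarFactor G H₂ →
     weight w H₁ ≡ weight w H₂)

IsLeaf : ∀ {n} → Graph n → Fin n → Set
IsLeaf G v = deg G v ≡ 1

IsStem : ∀ {n} → Graph n → Fin n → Set
IsStem G v = ∃ λ u → Edge G v u × IsLeaf G u

Remaining : ∀ {n} → Graph n → Fin n → Set
Remaining G v = ¬ IsLeaf G v × ¬ IsStem G v

EdgeRem : ∀ {n} → Graph n → Fin n → Fin n → Set
EdgeRem G u v = Remaining G u × Remaining G v × Edge G u v

RemainderCondition : ∀ {n} → Graph n → Set
RemainderCondition {n} G =
  ∀ (v : Fin n) → Remaining G v →
    Σ ℕ λ m → Σ (Fin (suc m) → Fin n) λ f →
      IsStarK1 (EdgeRem G) (Reach (EdgeRem G) v) m f ×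
      (2 ≤ m → deg G (f zero) ≡ m)

module Submission where

-- Call a vertex of G − (L ∪ S) with at least two neighbours there a centre, and call the leaves of G
-- and the remaining vertices that are not centres tips. Under the remainder condition every
-- star-factor gives each tip degree one and has no edge avoiding the tips, so weighting an edge by
-- its number of tip endpoints (by 1 if it has none) gives every star-factor weight |tips|.
-- Conversely, let all star-factors have equal weight. If G − (L ∪ S) contained a path a b c d, or a
-- centre c adjacent to a stem s, then star forests of the branches of the tree at that configuration
-- assemble into four star-factors whose edges satisfy H₁ + H₄ + bc = H₂ + H₃ (resp.
-- H₂ + H₄ + cs = H₁ + H₃), forcing the positive weight of bc (resp. cs) to vanish. Excluding both
-- configurations makes every component of G − (L ∪ S) a star whose centre has all its G-neighbours
-- in G − (L ∪ S).

open import Defs renaming (sym to adj-sym)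
open import Data.Nat using (ℕ; zero; suc; _+_; _≤_; _<_; z≤n; s≤s; _≤?_; _≟_)
open import Data.Nat.Properties
  using (+-0-commutativeMonoid; ≤-refl; ≤-trans; ≤-pred; +-mono-≤; +-mono-<-≤; +-mono-≤-<; m≤m+n; m≤n+m;
         <-irrefl; n≮0; +-identityʳ; +-cancelˡ-≡)
open import Data.Nat.ListAction using () renaming (sum to listSum)
open import Data.Nat.Tactic.RingSolver using (solve-∀)
open import Data.Fin using (Fin; zero; suc; inject₁; fromℕ; _<?_)
open import Data.Fin.Properties using (injective⇒≤; suc-injective; any?; all?; <-cmp; ¬∀⟶∃¬) renaming (_≟_ to _≟F_)
open import Data.Bool using (Bool; true; false; if_then_else_; _∧_; _∨_; not)
open import Data.Bool.Properties using (∨-zeroʳ; ∧-comm; ∧-zeroʳ; ∧-conicalˡ; ∧-conicalʳ; ¬-not) renaming (_≟_ to _≟ᵇ_)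
open import Data.List using (List; []; _∷_; map; allFin; tabulate; length; lookup)
open import Data.List.Relation.Unary.All using (All; []; _∷_) renaming (map to All-map)
open import Data.List.Relation.Unary.All.Properties using (¬Any⇒All¬)
open import Data.List.Relation.Unary.AllPairs using (AllPairs; []; _∷_)
open import Data.List.Relation.Unary.Any using (here; there)
open import Data.List.Membership.Propositional using (_∈_)
import Data.List.Membership.DecPropositional as DecMembership
open import Data.Product using (Σ; ∃; _×_; _,_; proj₁; proj₂)
open import Data.Sum using (_⊎_; inj₁; inj₂; [_,_]′)
import Data.Sum
open import Data.Unit using (⊤; tt)
open import Data.Empty using (⊥; ⊥-elim)
open import Relation.Nullary using (¬_; Dec; yes; no; does)
open import Relation.Nullary.Decidable using (dec-true; dec-false; _×-dec_; _⊎-dec_; _→-dec_; ¬?)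
open import Relation.Binary.Definitions using (Tri; tri<; tri≈; tri>)
open import Relation.Binary.PropositionalEquality
  using (_≡_; _≢_; refl; sym; trans; cong; cong₂; subst; ≢-sym; module ≡-Reasoning)
open import Function.Bundles using (_⇔_; mk⇔; module Equivalence)
open import Function.Definitions using (Injective)
import Algebra.Properties.CommutativeMonoid.Sum as MonoidSum

open MonoidSum +-0-commutativeMonoid using (∑-distrib-+; ∑-comm; sum-cong-≗) renaming (sum to ∑)
open Equivalence using (to; from)

-- Sums and counting over Fin n

indicator : Bool → ℕ
indicator true = 1
indicator false = 0

listSum-map-tabulate : ∀ {n} {A : Set} (f : A → ℕ) (g : Fin n → A) →
                       listSum (map f (tabulate g)) ≡ ∑ (λ i → f (g i))
listSum-map-tabulate {zero} f g = refl
listSum-map-tabulate {suc n} f g = cong (f (g zero) +_) (listSum-map-tabulate f (λ i → g (suc i)))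

listSum-allFin : ∀ {n} (f : Fin n → ℕ) → listSum (map f (allFin n)) ≡ ∑ f
listSum-allFin f = listSum-map-tabulate f (λ i → i)

∑-mono-≤ : ∀ {n} {f g : Fin n → ℕ} → (∀ i → f i ≤ g i) → ∑ f ≤ ∑ g
∑-mono-≤ {zero} f≤g = z≤n
∑-mono-≤ {suc n} f≤g = +-mono-≤ (f≤g zero) (∑-mono-≤ (λ i → f≤g (suc i)))

∑-mono-< : ∀ {n} {f g : Fin n → ℕ} → (∀ i → f i ≤ g i) → (j : Fin n) → f j < g j → ∑ f < ∑ g
∑-mono-< {suc n} f≤g zero fj<gj = +-mono-<-≤ fj<gj (∑-mono-≤ (λ i → f≤g (suc i)))
∑-mono-< {suc n} f≤g (suc j) fj<gj = +-mono-≤-< (f≤g zero) (∑-mono-< (λ i → f≤g (suc i)) j fj<gj)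

term≤∑ : ∀ {n} (f : Fin n → ℕ) (j : Fin n) → f j ≤ ∑ f
term≤∑ {suc n} f zero = m≤m+n (f zero) _
term≤∑ {suc n} f (suc j) = ≤-trans (term≤∑ (λ i → f (suc i)) j) (m≤n+m _ (f zero))

count : ∀ {n} → (Fin n → Bool) → ℕ
count p = ∑ (λ u → indicator (p u))

indicator-mono : ∀ {a b} → (a ≡ true → b ≡ true) → indicator a ≤ indicator b
indicator-mono {false} a⇒b = z≤n
indicator-mono {true} a⇒b rewrite a⇒b refl = ≤-refl

count-mono : ∀ {n} {p q : Fin n → Bool} → (∀ u → p u ≡ true → q u ≡ true) → count p ≤ count q
count-mono p⊆q = ∑-mono-≤ (λ u → indicator-mono (p⊆q u))

count-mono-< : ∀ {n} {p q : Fin n → Bool} → (∀ u → p u ≡ true → q u ≡ true) →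
               (j : Fin n) → p j ≡ false → q j ≡ true → count p < count q
count-mono-< {p = p} {q} p⊆q j pj qj = ∑-mono-< (λ u → indicator-mono (p⊆q u)) j ind<
  where
  ind< : indicator (p j) < indicator (q j)
  ind< rewrite pj | qj = s≤s z≤n

count-cong : ∀ {n} {p q : Fin n → Bool} → (∀ u → p u ≡ q u) → count p ≡ count q
count-cong p≗q = sum-cong-≗ (λ u → cong indicator (p≗q u))

count≡0 : ∀ {n} {p : Fin n → Bool} → (∀ u → p u ≡ false) → count p ≡ 0
count≡0 {zero} _ = refl
count≡0 {suc n} {p} p≡false rewrite p≡false zero = count≡0 {p = λ i → p (suc i)} (λ i → p≡false (suc i))

count≡1 : ∀ {n} {p : Fin n → Bool} (u : Fin n) → p u ≡ true → (∀ v → p v ≡ true → v ≡ u) → count p ≡ 1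
count≡1 {suc n} {p} zero pu unique rewrite pu = cong suc (count≡0 {p = λ i → p (suc i)} rest)
  where
  rest : ∀ i → p (suc i) ≡ false
  rest i with p (suc i) in eq
  ... | false = refl
  ... | true with unique (suc i) eq
  ...   | ()
count≡1 {suc n} {p} (suc u) pu unique with p zero in eq
... | true with unique zero eq
...   | ()
count≡1 {suc n} {p} (suc u) pu unique | false =
  count≡1 {p = λ i → p (suc i)} u pu (λ v pv → suc-injective (unique (suc v) pv))

enumerate : ∀ {n} (p : Fin n → Bool) → Fin (count p) → Fin n
enumerate {suc n} p i with p zero
enumerate {suc n} p zero | true = zero
enumerate {suc n} p (suc i) | true = suc (enumerate (λ j → p (suc j)) i)
enumerate {suc n} p i | false = suc (enumerate (λ j → p (suc j)) i)

enumerate-sound : ∀ {n} (p : Fin n → Bool) (i : Fin (count p)) → p (enumerate p i) ≡ true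
enumerate-sound {suc n} p i with p zero in eq
enumerate-sound {suc n} p zero | true = eq
enumerate-sound {suc n} p (suc i) | true = enumerate-sound (λ j → p (suc j)) i
enumerate-sound {suc n} p i | false = enumerate-sound (λ j → p (suc j)) i

enumerate-injective : ∀ {n} (p : Fin n → Bool) → Injective _≡_ _≡_ (enumerate p)
enumerate-injective {suc n} p {i} {j} eq with p zero
enumerate-injective {suc n} p {zero} {zero} eq | true = refl
enumerate-injective {suc n} p {suc i} {suc j} eq | true =
  cong suc (enumerate-injective (λ k → p (suc k)) (suc-injective eq))
enumerate-injective {suc n} p {i} {j} eq | false = enumerate-injective (λ k → p (suc k)) (suc-injective eq)

enumerate-complete : ∀ {n} (p : Fin n → Bool) (u : Fin n) → p u ≡ true → ∃ λ i → enumerate p i ≡ u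
enumerate-complete {suc n} p u pu with p zero in eq
enumerate-complete {suc n} p zero pu | true = zero , refl
enumerate-complete {suc n} p (suc u) pu | true with enumerate-complete (λ k → p (suc k)) u pu
... | i , refl = suc i , refl
enumerate-complete {suc n} p zero pu | false with trans (sym pu) eq
... | ()
enumerate-complete {suc n} p (suc u) pu | false with enumerate-complete (λ k → p (suc k)) u pu
... | i , refl = i , refl

injection⇒≤count : ∀ {n m} (p : Fin n → Bool) (g : Fin m → Fin n) → Injective _≡_ _≡_ g →
                   (∀ j → p (g j) ≡ true) → m ≤ count p
injection⇒≤count p g g-inj g⊆p = injective⇒≤ {f = index} index-inj
  where
  index : _ → Fin (count p)
  index j = proj₁ (enumerate-complete p (g j) (g⊆p j))
  index-inj : Injective _≡_ _≡_ index
  index-inj {x} {y} eq = g-inj (begin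
    g x                         ≡⟨ sym (proj₂ (enumerate-complete p (g x) (g⊆p x))) ⟩
    enumerate p (index x)       ≡⟨ cong (enumerate p) eq ⟩
    enumerate p (index y)       ≡⟨ proj₂ (enumerate-complete p (g y) (g⊆p y)) ⟩
    g y                         ∎)
    where open ≡-Reasoning

pair : ∀ {n} → Fin n → Fin n → Fin 2 → Fin n
pair u v zero = u
pair u v (suc zero) = v

pair-injective : ∀ {n} {u v : Fin n} → u ≢ v → Injective _≡_ _≡_ (pair u v)
pair-injective u≢v {zero} {zero} eq = refl
pair-injective u≢v {zero} {suc zero} eq = ⊥-elim (u≢v eq)
pair-injective u≢v {suc zero} {zero} eq = ⊥-elim (u≢v (sym eq))
pair-injective u≢v {suc zero} {suc zero} eq = refl

distinct⇒2≤ : ∀ {m} {a b : Fin m} → a ≢ b → 2 ≤ m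
distinct⇒2≤ a≢b = injective⇒≤ (pair-injective a≢b)

1≤count : ∀ {n} {p : Fin n → Bool} (u : Fin n) → p u ≡ true → 1 ≤ count p
1≤count {p = p} u pu = injection⇒≤count p (λ _ → u) (λ { {zero} {zero} _ → refl }) (λ _ → pu)

2≤count : ∀ {n} {p : Fin n → Bool} (u v : Fin n) → p u ≡ true → p v ≡ true → u ≢ v → 2 ≤ count p
2≤count {p = p} u v pu pv u≢v = injection⇒≤count p (pair u v) (pair-injective u≢v) pair⊆p
  where
  pair⊆p : ∀ j → p (pair u v j) ≡ true
  pair⊆p zero = pu
  pair⊆p (suc zero) = pv

1≤count⇒witness : ∀ {n} (p : Fin n → Bool) → 1 ≤ count p → ∃ λ u → p u ≡ true
1≤count⇒witness p 1≤c with count p | enumerate p | enumerate-sound p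
... | suc c | e | e-sound = e zero , e-sound zero

2≤count⇒two-witnesses : ∀ {n} (p : Fin n → Bool) → 2 ≤ count p →
                        Σ (Fin n) λ u → Σ (Fin n) λ v → p u ≡ true × p v ≡ true × u ≢ v
2≤count⇒two-witnesses p 2≤c with count p | enumerate p | enumerate-sound p | enumerate-injective p
... | suc zero | _ | _ | _ = ⊥-elim (<-irrefl refl 2≤c)
... | suc (suc c) | e | e-sound | e-inj =
  e zero , e (suc zero) , e-sound zero , e-sound (suc zero) , λ eq → 0≢1 (e-inj eq)
  where
  0≢1 : zero ≢ suc zero
  0≢1 ()

-- Stars and star-factors

does⇒ : ∀ {P : Set} (P? : Dec P) → does P? ≡ true → P
does⇒ (yes p) _ = p

Reach-snoc : ∀ {n} {R : Fin n → Fin n → Set} {a b c} → Reach R a b → R b c → Reach R a c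
Reach-snoc here r = step r here
Reach-snoc (step r rs) r′ = step r (Reach-snoc rs r′)

Reach-trans : ∀ {n} {R : Fin n → Fin n → Set} {a b c} → Reach R a b → Reach R b c → Reach R a c
Reach-trans here r = r
Reach-trans (step x r) r′ = step x (Reach-trans r r′)

Reach-sym : ∀ {n} {R : Fin n → Fin n → Set} → (∀ {x y} → R x y → R y x) → ∀ {a b} → Reach R a b → Reach R b a
Reach-sym R-sym here = here
Reach-sym R-sym (step x r) = Reach-snoc (Reach-sym R-sym r) (R-sym x)

Edge? : ∀ {n} (H : Graph n) u v → Dec (Edge H u v)
Edge? H u v = adj H u v ≟ᵇ true

edge-sym : ∀ {n} (H : Graph n) {u v} → Edge H u v → Edge H v u
edge-sym H {u} {v} e = trans (sym (adj-sym H u v)) e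

edge-irrefl : ∀ {n} (H : Graph n) {u} → ¬ Edge H u u
edge-irrefl H {u} e with trans (sym e) (irrfl H u)
... | ()

edge⇒≢ : ∀ {n} (H : Graph n) {u v} → Edge H u v → u ≢ v
edge⇒≢ H e refl = edge-irrefl H e

Pendant : ∀ {n} → Graph n → Fin n → Set
Pendant {n} H x = Σ (Fin n) λ u → Edge H x u × (∀ u′ → Edge H x u′ → u′ ≡ u)

NonIsolated : ∀ {n} → Graph n → Fin n → Set
NonIsolated {n} H x = Σ (Fin n) λ u → Edge H x u

Pendant? : ∀ {n} (H : Graph n) x → Dec (Pendant H x)
Pendant? H x = any? (λ u → Edge? H x u ×-dec all? (λ u′ → Edge? H x u′ →-dec (u′ ≟F u)))

module StarAround {n : ℕ} (E : Fin n → Fin n → Set) (E? : ∀ u v → Dec (E u v))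
                  (E-sym : ∀ {u v} → E u v → E v u) (E-irrefl : ∀ {u} → ¬ E u u) where

  neighbours : Fin n → Fin n → Bool
  neighbours c u = does (E? c u)

  star : (c : Fin n) → Fin (suc (count (neighbours c))) → Fin n
  star c zero = c
  star c (suc i) = enumerate (neighbours c) i

  IsHub : Fin n → Set
  IsHub c = ∀ x y → E c x → E x y → y ≡ c

  InStar : Fin n → Fin n → Set
  InStar c u = u ≡ c ⊎ E c u

  InStar-closed : ∀ {c} → IsHub c → ∀ {u w} → Reach E u w → InStar c u → InStar c w
  InStar-closed hub here u∈ = u∈
  InStar-closed hub (step e r) (inj₁ refl) = InStar-closed hub r (inj₂ e)
  InStar-closed hub (step e r) (inj₂ ecu) = InStar-closed hub r (inj₁ (hub _ _ ecu e))

  star-isStar : ∀ {c} → IsHub c → ∀ {v} → InStar c v → IsStarK1 E (Reach E v) (count (neighbours c)) (star c)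
  star-isStar {c} hub {v} v∈ = star-injective , reach , onto , edges
    where
    spoke : ∀ i → E c (enumerate (neighbours c) i)
    spoke i = does⇒ (E? c _) (enumerate-sound (neighbours c) i)
    c∉ : ∀ i → enumerate (neighbours c) i ≢ c
    c∉ i eq = E-irrefl (subst (E c) eq (spoke i))
    star-injective : Injective _≡_ _≡_ (star c)
    star-injective {zero} {zero} eq = refl
    star-injective {zero} {suc j} eq = ⊥-elim (c∉ j (sym eq))
    star-injective {suc i} {zero} eq = ⊥-elim (c∉ i eq)
    star-injective {suc i} {suc j} eq = cong suc (enumerate-injective (neighbours c) eq)
    InStar⇒⇝c : ∀ {u} → InStar c u → Reach E u c
    InStar⇒⇝c (inj₁ refl) = here
    InStar⇒⇝c (inj₂ e) = step (E-sym e) here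
    v⇝c : Reach E v c
    v⇝c = InStar⇒⇝c v∈
    reach : ∀ i → Reach E v (star c i)
    reach zero = v⇝c
    reach (suc i) = Reach-snoc v⇝c (spoke i)
    onto′ : ∀ u → InStar c u → ∃ λ i → star c i ≡ u
    onto′ u (inj₁ refl) = zero , refl
    onto′ u (inj₂ e) with enumerate-complete (neighbours c) u (dec-true (E? c u) e)
    ... | i , eq = suc i , eq
    onto : ∀ u → Reach E v u → ∃ λ i → star c i ≡ u
    onto u r = onto′ u (InStar-closed hub r v∈)
    edges : ∀ i j → E (star c i) (star c j) ⇔ ((i ≡ zero × j ≢ zero) ⊎ (j ≡ zero × i ≢ zero))
    edges zero zero = mk⇔ (λ e → ⊥-elim (E-irrefl e)) λ { (inj₁ (_ , j≢0)) → ⊥-elim (j≢0 refl)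
                                                      ; (inj₂ (_ , i≢0)) → ⊥-elim (i≢0 refl) }
    edges zero (suc j) = mk⇔ (λ _ → inj₁ (refl , λ ())) (λ _ → spoke j)
    edges (suc i) zero = mk⇔ (λ _ → inj₂ (refl , λ ())) (λ _ → E-sym (spoke i))
    edges (suc i) (suc j) = mk⇔ (λ e → ⊥-elim (c∉ j (hub _ _ (spoke i) e)))
                                 (λ { (inj₁ (() , _)) ; (inj₂ (() , _)) })

PendantEnds : ∀ {n} → Graph n → Set
PendantEnds H = ∀ u v → Edge H u v → Pendant H u ⊎ Pendant H v

module _ {n : ℕ} (H : Graph n) where
  open StarAround (Edge H) (Edge? H) (edge-sym H) (edge-irrefl H)

  pendantNeighbours⇒hub : ∀ {c} → (∀ x → Edge H c x → Pendant H x) → IsHub c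
  pendantNeighbours⇒hub {c} pend x y ecx exy with pend x ecx
  ... | z , _ , unique = trans (unique y exy) (sym (unique c (edge-sym H ecx)))

  nonPendant⇒pendantNeighbours : PendantEnds H → ∀ {c} → ¬ Pendant H c → ∀ x → Edge H c x → Pendant H x
  nonPendant⇒pendantNeighbours ends ¬pc x ecx with ends _ x ecx
  ... | inj₁ pc = ⊥-elim (¬pc pc)
  ... | inj₂ px = px

  starComponent : ∀ {c v} → IsHub c → InStar c v → ∀ {w} → Edge H c w →
                  Σ ℕ λ m → Σ (Fin (suc m) → Fin n) λ f → 1 ≤ m × IsStarK1 (Edge H) (Reach (Edge H) v) m f
  starComponent {c} hub v∈ ecw =
    count (neighbours c) , star c , 1≤count {p = neighbours c} _ (dec-true (Edge? H c _) ecw) , star-isStar hub v∈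

locallyStar⇒starFactor : ∀ {n} (G H : Graph n) → Subgraph H G → (∀ v → NonIsolated H v) → PendantEnds H →
                         IsStarFactor G H
locallyStar⇒starFactor {n} G H H⊆G nonIsolated ends = H⊆G , component
  where
  component : ∀ v → Σ ℕ λ m → Σ (Fin (suc m) → Fin n) λ f → 1 ≤ m × IsStarK1 (Edge H) (Reach (Edge H) v) m f
  component v with Pendant? H v
  ... | no ¬pv = starComponent H (pendantNeighbours⇒hub H (nonPendant⇒pendantNeighbours H ends ¬pv))
                               (inj₁ refl) (proj₂ (nonIsolated v))
  ... | yes (u , evu , unique) with Pendant? H u
  ...   | no ¬pu = starComponent H (pendantNeighbours⇒hub H (nonPendant⇒pendantNeighbours H ends ¬pu))
                                 (inj₂ (edge-sym H evu)) (edge-sym H evu)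
  ...   | yes pu = starComponent H (pendantNeighbours⇒hub H (λ x evx → subst (Pendant H) (sym (unique x evx)) pu))
                                 (inj₁ refl) evu

starLeaf⇒pendant : ∀ {n} {H : Graph n} {u m} {f : Fin (suc m) → Fin n} → IsStarK1 (Edge H) (Reach (Edge H) u) m f →
                 ∀ k → k ≢ zero → Reach (Edge H) u (f k) → Pendant H (f k)
starLeaf⇒pendant {H = H} {f = f} (_ , _ , onto , edges) k k≢0 r = f zero , from (edges k zero) (inj₂ (refl , k≢0)) , unique
  where
  unique : ∀ y → Edge H (f k) y → y ≡ f zero
  unique y e with onto y (Reach-snoc r e)
  ... | l , refl with to (edges k l) e
  ... | inj₁ (k≡0 , _) = ⊥-elim (k≢0 k≡0)
  ... | inj₂ (refl , _) = refl

module _ {n : ℕ} {G H : Graph n} (factor : IsStarFactor G H) where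

  starFactor⇒nonIsolated : ∀ v → NonIsolated H v
  starFactor⇒nonIsolated v with proj₂ factor v
  ... | suc m , f , _ , _ , _ , onto , edges with onto v here
  ... | zero , refl = f (suc zero) , from (edges zero (suc zero)) (inj₁ (refl , λ ()))
  ... | suc j , refl = f zero , from (edges (suc j) zero) (inj₂ (refl , λ ()))

  starFactor⇒pendantEnds : PendantEnds H
  starFactor⇒pendantEnds u v euv with proj₂ factor u
  ... | m , f , _ , isStar@(_ , _ , onto , edges) with onto u here | onto v (step euv here)
  ... | i , refl | j , refl with to (edges i j) euv
  ... | inj₁ (_ , j≢0) = inj₂ (starLeaf⇒pendant {H = H} isStar j j≢0 (step euv here))
  ... | inj₂ (_ , i≢0) = inj₁ (starLeaf⇒pendant {H = H} isStar i i≢0 here)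

module _ {n : ℕ} {E : Fin n → Fin n → Set} {v : Fin n} {m : ℕ} {f : Fin (suc m) → Fin n}
         (isStar : IsStarK1 E (Reach E v) m f) where

  private
    onto : ∀ u → Reach E v u → ∃ λ i → f i ≡ u
    onto = proj₁ (proj₂ (proj₂ isStar))
    edges : ∀ i j → E (f i) (f j) ⇔ ((i ≡ zero × j ≢ zero) ⊎ (j ≡ zero × i ≢ zero))
    edges = proj₂ (proj₂ (proj₂ isStar))

  centreEdge⇒leaf : ∀ {j} → E (f zero) (f j) → j ≢ zero
  centreEdge⇒leaf {j} e with to (edges zero j) e
  ... | inj₁ (_ , j≢0) = j≢0
  ... | inj₂ (_ , 0≢0) = ⊥-elim (0≢0 refl)

  branching⇒centre : ∀ {u x y} → Reach E v u → Reach E v x → Reach E v y → E u x → E u y → x ≢ y →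
                     u ≡ f zero × 2 ≤ m
  branching⇒centre {u} {x} {y} v⇝u v⇝x v⇝y eux euy x≢y
    with onto u v⇝u | onto x v⇝x | onto y v⇝y
  ... | i , refl | j , refl | k , refl with i≡0
    where
    i≡0 : i ≡ zero
    i≡0 with to (edges i j) eux | to (edges i k) euy
    ... | inj₁ (i≡0 , _) | _ = i≡0
    ... | _ | inj₁ (i≡0 , _) = i≡0
    ... | inj₂ (j≡0 , _) | inj₂ (k≡0 , _) = ⊥-elim (x≢y (cong f (trans j≡0 (sym k≡0))))
  ... | refl = refl , twoLeaves j k (centreEdge⇒leaf eux) (centreEdge⇒leaf euy) (λ j≡k → x≢y (cong f j≡k))
    where
    twoLeaves : ∀ (j k : Fin (suc m)) → j ≢ zero → k ≢ zero → j ≢ k → 2 ≤ m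
    twoLeaves zero _ j≢0 _ _ = ⊥-elim (j≢0 refl)
    twoLeaves (suc j) zero _ k≢0 _ = ⊥-elim (k≢0 refl)
    twoLeaves (suc j) (suc k) _ _ j≢k = distinct⇒2≤ (λ eq → j≢k (cong suc eq))

-- Leaves, stems and the remainder G − (L ∪ S)

indicator-if : ∀ b → (if b then 1 else 0) ≡ indicator b
indicator-if true = refl
indicator-if false = refl

module Classification {n : ℕ} (G : Graph n) where

  deg≡count : ∀ v → deg G v ≡ count (adj G v)
  deg≡count v = trans (listSum-allFin (λ u → if adj G v u then 1 else 0)) (sum-cong-≗ (λ u → indicator-if (adj G v u)))

  Leaf? : ∀ v → Dec (IsLeaf G v)
  Leaf? v = deg G v ≟ 1

  Stem? : ∀ v → Dec (IsStem G v)
  Stem? v = any? (λ u → Edge? G v u ×-dec Leaf? u)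

  Remaining? : ∀ v → Dec (Remaining G v)
  Remaining? v = ¬? (Leaf? v) ×-dec ¬? (Stem? v)

  EdgeRem? : ∀ u v → Dec (EdgeRem G u v)
  EdgeRem? u v = Remaining? u ×-dec (Remaining? v ×-dec Edge? G u v)

  remainingNeighbours : Fin n → Fin n → Bool
  remainingNeighbours u v = does (EdgeRem? u v)

  EdgeRem-sym : ∀ {u v} → EdgeRem G u v → EdgeRem G v u
  EdgeRem-sym (ru , rv , e) = rv , ru , edge-sym G e

  EdgeRem-irrefl : ∀ {u} → ¬ EdgeRem G u u
  EdgeRem-irrefl (_ , _ , e) = edge-irrefl G e

  leaf⇒pendant : ∀ {ℓ} → IsLeaf G ℓ → Pendant G ℓ
  leaf⇒pendant {ℓ} leaf with 1≤count⇒witness (adj G ℓ) (subst (1 ≤_) (trans (sym leaf) (deg≡count ℓ)) ≤-refl)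
  ... | s , es = s , es , unique
    where
    unique : ∀ s′ → Edge G ℓ s′ → s′ ≡ s
    unique s′ es′ with s′ ≟F s
    ... | yes eq = eq
    ... | no s′≢s = ⊥-elim (<-irrefl refl (subst (2 ≤_) (trans (sym (deg≡count ℓ)) leaf) (2≤count s′ s es′ es s′≢s)))

  pendant⇒leaf : ∀ {u} → Pendant G u → IsLeaf G u
  pendant⇒leaf {u} (p , eup , unique) = trans (deg≡count u) (count≡1 p eup unique)

  onlyNeighbour⇒stem : ∀ {u p} → Edge G u p → (∀ t → Edge G u t → t ≡ p) → IsStem G p
  onlyNeighbour⇒stem eup unique = _ , edge-sym G eup , pendant⇒leaf (_ , eup , unique)

  twoRemainingNeighbours : ∀ {c} → 2 ≤ count (remainingNeighbours c) →
                           Σ (Fin n) λ x → Σ (Fin n) λ y → EdgeRem G c x × EdgeRem G c y × x ≢ y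
  twoRemainingNeighbours {c} 2≤ with 2≤count⇒two-witnesses (remainingNeighbours c) 2≤
  ... | x , y , cx , cy , x≢y = x , y , does⇒ (EdgeRem? c x) cx , does⇒ (EdgeRem? c y) cy , x≢y

  Centre : Fin n → Set
  Centre v = Remaining G v × 2 ≤ count (remainingNeighbours v)

  Centre? : ∀ v → Dec (Centre v)
  Centre? v = Remaining? v ×-dec (2 ≤? count (remainingNeighbours v))

  Tip : Fin n → Set
  Tip v = IsLeaf G v ⊎ (Remaining G v × ¬ Centre v)

  Tip? : ∀ v → Dec (Tip v)
  Tip? v = Leaf? v ⊎-dec (Remaining? v ×-dec ¬? (Centre? v))

  isTip : Fin n → Bool
  isTip v = does (Tip? v)

  nonTip⇒stemOrCentre : ∀ {u} → ¬ Tip u → IsStem G u ⊎ Centre u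
  nonTip⇒stemOrCentre {u} ¬tip with Remaining? u
  ... | yes rem with Centre? u
  ...   | yes centre = inj₂ centre
  ...   | no ¬centre = ⊥-elim (¬tip (inj₂ (rem , ¬centre)))
  nonTip⇒stemOrCentre {u} ¬tip | no ¬rem with Stem? u
  ...   | yes stem = inj₁ stem
  ...   | no ¬stem = ⊥-elim (¬rem ((λ leaf → ¬tip (inj₁ leaf)) , ¬stem))

module UnderRemainderCondition {n : ℕ} (G : Graph n) (condition : RemainderCondition G) where
  open Classification G

  record CentreStar (c : Fin n) : Set where
    field
      size : ℕ
      star : Fin (suc size) → Fin n
      isStar : IsStarK1 (EdgeRem G) (Reach (EdgeRem G) c) size star
      star₀≡c : star zero ≡ c
      degree : deg G c ≡ size

  centreStar : ∀ {c} → Centre c → CentreStar c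
  centreStar {c} centre@(rem , _) with condition c rem | twoRemainingNeighbours (proj₂ centre)
  ... | m , f , isStar , degree | x , y , ecx , ecy , x≢y
    with branching⇒centre isStar here (step ecx here) (step ecy here) ecx ecy x≢y
  ... | c≡f0 , 2≤m = record { size = m ; star = f ; isStar = isStar ; star₀≡c = sym c≡f0
                            ; degree = subst (λ z → deg G z ≡ m) (sym c≡f0) (degree 2≤m) }

  centreNeighbour⇒remaining : ∀ {c s} → Centre c → Edge G c s → Remaining G s
  centreNeighbour⇒remaining {c} {s} centre ecs with Remaining? s
  ... | yes rem = rem
  ... | no ¬rem = ⊥-elim (<-irrefl refl (subst (suc m ≤_) (trans (sym (deg≡count c)) degree) m+1≤deg))
    where
    open CentreStar (centreStar centre) renaming (size to m; star to f)
    spoke : ∀ j → EdgeRem G c (f (suc j))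
    spoke j = subst (λ z → EdgeRem G z (f (suc j))) star₀≡c
                    (from (proj₂ (proj₂ (proj₂ isStar)) zero (suc j)) (inj₁ (refl , λ ())))
    g : Fin (suc m) → Fin n
    g zero = s
    g (suc j) = f (suc j)
    g-injective : Injective _≡_ _≡_ g
    g-injective {zero} {zero} eq = refl
    g-injective {zero} {suc j} eq = ⊥-elim (¬rem (subst (Remaining G) (sym eq) (proj₁ (proj₂ (spoke j)))))
    g-injective {suc i} {zero} eq = ⊥-elim (¬rem (subst (Remaining G) eq (proj₁ (proj₂ (spoke i)))))
    g-injective {suc i} {suc j} eq = proj₁ isStar eq
    g-adjacent : ∀ j → adj G c (g j) ≡ true
    g-adjacent zero = ecs
    g-adjacent (suc j) = proj₂ (proj₂ (spoke j))
    m+1≤deg : suc m ≤ count (adj G c)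
    m+1≤deg = injection⇒≤count (adj G c) g g-injective g-adjacent

  centres-nonadjacent : ∀ {c c′} → Centre c → Centre c′ → ¬ Edge G c c′
  centres-nonadjacent {c} {c′} centre centre′ ecc′ with twoRemainingNeighbours (proj₂ centre′)
  ... | x , y , ec′x , ec′y , x≢y
    with branching⇒centre isStar (step ecc′R here) (step ecc′R (step ec′x here)) (step ecc′R (step ec′y here))
                          ec′x ec′y x≢y
    where
    open CentreStar (centreStar centre)
    ecc′R : EdgeRem G c c′
    ecc′R = proj₁ centre , proj₁ centre′ , ecc′
  ... | c′≡f0 , _ = edge-irrefl G (subst (Edge G c) (trans c′≡f0 (CentreStar.star₀≡c (centreStar centre))) ecc′)

-- Weightings constant on star-factors

edgeTerm : ∀ {n} → Weighting n → Graph n → Fin n → Fin n → ℕ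
edgeTerm w H u v = if adj H u v then (if does (u <? v) then w u v else 0) else 0

weight≡∑∑ : ∀ {n} (w : Weighting n) (H : Graph n) → weight w H ≡ ∑ (λ u → ∑ (edgeTerm w H u))
weight≡∑∑ {n} w H = trans (listSum-allFin (λ u → listSum (map (edgeTerm w H u) (allFin n))))
                          (sum-cong-≗ (λ u → listSum-allFin (edgeTerm w H u)))

exactlyOneOrder : ∀ {n} (u v : Fin n) → u ≢ v → indicator (does (u <? v)) + indicator (does (v <? u)) ≡ 1
exactlyOneOrder u v u≢v with <-cmp u v
... | tri< u<v _ v≮u rewrite dec-true (u <? v) u<v | dec-false (v <? u) v≮u = refl
... | tri≈ _ u≡v _ = ⊥-elim (u≢v u≡v)
... | tri> u≮v _ v<u rewrite dec-false (u <? v) u≮v | dec-true (v <? u) v<u = refl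

weight≡endpointShares : ∀ {n} (w : Weighting n) (H : Graph n) (t : Fin n → ℕ) →
                        (∀ u v → Edge H u v → w u v ≡ t u + t v) →
                        weight w H ≡ ∑ (λ u → ∑ (λ v → if adj H u v then t u else 0))
weight≡endpointShares {n} w H t split = begin
  weight w H                                        ≡⟨ weight≡∑∑ w H ⟩
  ∑ (λ u → ∑ (edgeTerm w H u))                      ≡⟨ sum-cong-≗ splitRow ⟩
  ∑ (λ u → ∑ (P u) + ∑ (Q u))                       ≡⟨ ∑-distrib-+ (λ u → ∑ (P u)) (λ u → ∑ (Q u)) ⟩
  ∑ (λ u → ∑ (P u)) + ∑ (λ u → ∑ (Q u))             ≡⟨ cong (∑ (λ u → ∑ (P u)) +_) (∑-comm Q) ⟩
  ∑ (λ u → ∑ (P u)) + ∑ (λ u → ∑ (λ v → Q v u))     ≡⟨ ∑-distrib-+ (λ u → ∑ (P u)) (λ u → ∑ (λ v → Q v u)) ⟨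
  ∑ (λ u → ∑ (P u) + ∑ (λ v → Q v u))               ≡⟨ sum-cong-≗ mergeRow ⟩
  ∑ (λ u → ∑ (λ v → if adj H u v then t u else 0))  ∎
  where
  open ≡-Reasoning
  P Q : Fin n → Fin n → ℕ
  P u v = if adj H u v ∧ does (u <? v) then t u else 0
  Q u v = if adj H u v ∧ does (u <? v) then t v else 0
  term≡P+Q : ∀ u v → edgeTerm w H u v ≡ P u v + Q u v
  term≡P+Q u v with adj H u v in euv | does (u <? v)
  ... | false | _ = refl
  ... | true | false = refl
  ... | true | true = split u v euv
  splitRow : ∀ u → ∑ (edgeTerm w H u) ≡ ∑ (P u) + ∑ (Q u)
  splitRow u = trans (sum-cong-≗ (term≡P+Q u)) (∑-distrib-+ (P u) (Q u))
  P+Q≡share : ∀ u v → P u v + Q v u ≡ (if adj H u v then t u else 0)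
  P+Q≡share u v with adj H u v in euv
  ... | false rewrite trans (adj-sym H v u) euv = refl
  ... | true rewrite trans (adj-sym H v u) euv =
    share (does (u <? v)) (does (v <? u)) (exactlyOneOrder u v (edge⇒≢ H euv))
    where
    share : ∀ a b → indicator a + indicator b ≡ 1 → (if a then t u else 0) + (if b then t u else 0) ≡ t u
    share true false _ = +-identityʳ _
    share false true _ = refl
  mergeRow : ∀ u → ∑ (P u) + ∑ (λ v → Q v u) ≡ ∑ (λ v → if adj H u v then t u else 0)
  mergeRow u = trans (sym (∑-distrib-+ (P u) (λ v → Q v u))) (sum-cong-≗ (P+Q≡share u))

module TipWeighting {n : ℕ} (G : Graph n) (condition : RemainderCondition G) where
  open Classification G
  open UnderRemainderCondition G condition

  tipWeighting : Weighting n
  tipWeighting u v = if isTip u ∨ isTip v then indicator (isTip u) + indicator (isTip v) else 1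

  tipWeighting-positive : PositiveWeighting G tipWeighting
  tipWeighting-positive u v _ with isTip u | isTip v
  ... | true | _ = s≤s z≤n
  ... | false | true = s≤s z≤n
  ... | false | false = s≤s z≤n

  module _ {H : Graph n} (factor : IsStarFactor G H) where
    private
      H⊆G : Subgraph H G
      H⊆G = proj₁ factor
      pendantEnds : PendantEnds H
      pendantEnds = starFactor⇒pendantEnds {G = G} {H = H} factor
      nonIsolated : ∀ v → NonIsolated H v
      nonIsolated = starFactor⇒nonIsolated {G = G} {H = H} factor

    leafEdge∈factor : ∀ {ℓ s} → IsLeaf G ℓ → Edge G ℓ s → Edge H ℓ s
    leafEdge∈factor {ℓ} leaf eℓs with leaf⇒pendant leaf | nonIsolated ℓ
    ... | _ , _ , unique | z , eℓz = subst (Edge H ℓ) (trans (unique z (H⊆G ℓ z eℓz)) (sym (unique _ eℓs))) eℓz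

    pendantNeighbourOfLeaf⇒leaf : ∀ {u v ℓ} → Edge H u v → Pendant H v → Edge G v ℓ → IsLeaf G ℓ → IsLeaf G u
    pendantNeighbourOfLeaf⇒leaf {u} {v} {ℓ} euv (_ , _ , unique) evℓ leaf = subst (IsLeaf G) ℓ≡u leaf
      where
      ℓ≡u : ℓ ≡ u
      ℓ≡u = trans (unique _ (edge-sym H (leafEdge∈factor leaf (edge-sym G evℓ)))) (sym (unique _ (edge-sym H euv)))

    tip-uniqueNeighbour : ∀ {u x y} → Tip u → Edge H u x → Edge H u y → x ≡ y
    tip-uniqueNeighbour {u} {x} {y} (inj₁ leaf) eux euy with leaf⇒pendant leaf
    ... | _ , _ , unique = trans (unique x (H⊆G u x eux)) (sym (unique y (H⊆G u y euy)))
    tip-uniqueNeighbour {u} {x} {y} (inj₂ (rem , ¬centre)) eux euy with x ≟F y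
    ... | yes x≡y = x≡y
    ... | no x≢y = ⊥-elim (¬centre (rem , 2≤count x y (remainingEdge eux) (remainingEdge euy) x≢y))
      where
      u-notPendant : ¬ Pendant H u
      u-notPendant (_ , _ , unique) = x≢y (trans (unique x eux) (sym (unique y euy)))
      remainingEdge : ∀ {z} → Edge H u z → remainingNeighbours u z ≡ true
      remainingEdge {z} euz = dec-true (EdgeRem? u z) (rem , (z-notLeaf , z-notStem) , H⊆G u z euz)
        where
        z-notLeaf : ¬ IsLeaf G z
        z-notLeaf leaf = proj₂ rem (z , H⊆G u z euz , leaf)
        z-notStem : ¬ IsStem G z
        z-notStem (ℓ , ezℓ , leaf) with pendantEnds u z euz
        ... | inj₁ pu = u-notPendant pu
        ... | inj₂ pz = proj₁ rem (pendantNeighbourOfLeaf⇒leaf euz pz ezℓ leaf)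

    tip-degree≡1 : ∀ {u} → Tip u → count (adj H u) ≡ 1
    tip-degree≡1 {u} tip with nonIsolated u
    ... | x , eux = count≡1 x eux (λ y euy → tip-uniqueNeighbour tip euy eux)

    stem-notPendant : ∀ {u v} → IsStem G u → Edge H u v → ¬ IsLeaf G v → ¬ Pendant H u
    stem-notPendant (_ , euℓ , leaf) euv ¬leaf pu = ¬leaf (pendantNeighbourOfLeaf⇒leaf (edge-sym H euv) pu euℓ leaf)

    edge-meetsTip : ∀ u v → Edge H u v → Tip u ⊎ Tip v
    edge-meetsTip u v euv with Tip? u | Tip? v
    ... | yes tip | _ = inj₁ tip
    ... | no _ | yes tip = inj₂ tip
    ... | no ¬tu | no ¬tv with nonTip⇒stemOrCentre ¬tu | nonTip⇒stemOrCentre ¬tv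
    ... | inj₁ su | inj₁ sv =
      ⊥-elim ([ stem-notPendant su euv (notLeaf ¬tv) , stem-notPendant sv (edge-sym H euv) (notLeaf ¬tu) ]′ (pendantEnds u v euv))
      where
      notLeaf : ∀ {z} → ¬ Tip z → ¬ IsLeaf G z
      notLeaf ¬tip leaf = ¬tip (inj₁ leaf)
    ... | inj₁ su | inj₂ cv = ⊥-elim (proj₂ (centreNeighbour⇒remaining cv (edge-sym G (H⊆G u v euv))) su)
    ... | inj₂ cu | inj₁ sv = ⊥-elim (proj₂ (centreNeighbour⇒remaining cu (H⊆G u v euv)) sv)
    ... | inj₂ cu | inj₂ cv = ⊥-elim (centres-nonadjacent cu cv (H⊆G u v euv))

    tipWeighting-onFactor : ∀ u v → Edge H u v → tipWeighting u v ≡ indicator (isTip u) + indicator (isTip v)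
    tipWeighting-onFactor u v euv with edge-meetsTip u v euv
    ... | inj₁ tu rewrite dec-true (Tip? u) tu = refl
    ... | inj₂ tv rewrite dec-true (Tip? v) tv | ∨-zeroʳ (isTip u) = refl

    weight≡#tips : weight tipWeighting H ≡ count isTip
    weight≡#tips = trans (weight≡endpointShares tipWeighting H (λ u → indicator (isTip u)) tipWeighting-onFactor)
                         (sum-cong-≗ row)
      where
      row : ∀ u → ∑ (λ v → if adj H u v then indicator (isTip u) else 0) ≡ indicator (isTip u)
      row u with isTip u in tip
      ... | true = trans (sum-cong-≗ (λ v → indicator-if (adj H u v))) (tip-degree≡1 (does⇒ (Tip? u) tip))
      ... | false = trans (sum-cong-≗ (λ v → if-constant (adj H u v))) (count≡0 {n = n} {p = λ _ → false} (λ _ → refl))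
        where
        if-constant : ∀ b → (if b then 0 else 0) ≡ 0
        if-constant true = refl
        if-constant false = refl

  inΩ : InΩ G
  inΩ = tipWeighting , tipWeighting-positive ,
        λ H₁ H₂ F₁ F₂ → trans (weight≡#tips {H₁} F₁) (sym (weight≡#tips {H₂} F₂))

-- Assembling star forests

∨-true⇒ : ∀ {a b} → a ∨ b ≡ true → a ≡ true ⊎ b ≡ true
∨-true⇒ {true} _ = inj₁ refl
∨-true⇒ {false} b = inj₂ b

∨-trueˡ : ∀ {a} b → a ≡ true → a ∨ b ≡ true
∨-trueˡ b refl = refl

∨-trueʳ : ∀ a {b} → b ≡ true → a ∨ b ≡ true
∨-trueʳ true refl = refl
∨-trueʳ false refl = refl

∧-true : ∀ {a b} → a ≡ true → b ≡ true → a ∧ b ≡ true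
∧-true refl refl = refl

does-cong : ∀ {P Q : Set} (P? : Dec P) (Q? : Dec Q) → (P → Q) → (Q → P) → does P? ≡ does Q?
does-cong (yes p) Q? p⇒q _ = sym (dec-true Q? (p⇒q p))
does-cong (no ¬p) Q? _ q⇒p = sym (dec-false Q? (λ q → ¬p (q⇒p q)))

infixl 6 _∪ᴳ_ _∪_

_∪ᴳ_ : ∀ {n} → Graph n → Graph n → Graph n
H₁ ∪ᴳ H₂ = record
  { adj = λ u v → adj H₁ u v ∨ adj H₂ u v
  ; sym = λ u v → cong₂ _∨_ (adj-sym H₁ u v) (adj-sym H₂ u v)
  ; irrfl = λ v → cong₂ _∨_ (irrfl H₁ v) (irrfl H₂ v) }

∪-edge⇒ : ∀ {n} (H₁ H₂ : Graph n) {u v} → Edge (H₁ ∪ᴳ H₂) u v → Edge H₁ u v ⊎ Edge H₂ u v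
∪-edge⇒ _ _ = ∨-true⇒

keepEdges : ∀ {n} (H : Graph n) (keep : Fin n → Fin n → Bool) → (∀ u v → keep u v ≡ keep v u) → Graph n
keepEdges H keep keep-sym = record
  { adj = λ u v → adj H u v ∧ keep u v
  ; sym = λ u v → cong₂ _∧_ (adj-sym H u v) (keep-sym u v)
  ; irrfl = λ v → cong (_∧ keep v v) (irrfl H v) }

IsEdge : ∀ {n} → Fin n → Fin n → Fin n → Fin n → Set
IsEdge a b x y = (x ≡ a × y ≡ b) ⊎ (x ≡ b × y ≡ a)

IsEdge? : ∀ {n} (a b x y : Fin n) → Dec (IsEdge a b x y)
IsEdge? a b x y = (x ≟F a ×-dec y ≟F b) ⊎-dec (x ≟F b ×-dec y ≟F a)

IsEdge-sym : ∀ {n} {a b x y : Fin n} → IsEdge a b x y → IsEdge a b y x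
IsEdge-sym (inj₁ (p , q)) = inj₂ (q , p)
IsEdge-sym (inj₂ (p , q)) = inj₁ (q , p)

IsEdge?-sym : ∀ {n} (a b x y : Fin n) → does (IsEdge? a b x y) ≡ does (IsEdge? a b y x)
IsEdge?-sym a b x y = does-cong (IsEdge? a b x y) (IsEdge? a b y x) IsEdge-sym IsEdge-sym

_∪_ : ∀ {n} → (Fin n → Set) → (Fin n → Set) → Fin n → Set
(U ∪ V) u = U u ⊎ V u

⁅_⁆ : ∀ {n} → Fin n → Fin n → Set
⁅ x ⁆ u = u ≡ x

module StarForests {n : ℕ} (G : Graph n) where

  edgeGraph : Fin n → Fin n → Graph n
  edgeGraph a b = keepEdges G (λ x y → does (IsEdge? a b x y)) (IsEdge?-sym a b)

  module _ {a b : Fin n} where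
    edgeGraph-edge⇒ : ∀ {x y} → Edge (edgeGraph a b) x y → IsEdge a b x y
    edgeGraph-edge⇒ {x} {y} e = does⇒ (IsEdge? a b x y) (∧-conicalʳ (adj G x y) _ e)

    edgeGraph-edge : Edge G a b → ∀ {x y} → IsEdge a b x y → Edge (edgeGraph a b) x y
    edgeGraph-edge eab {x} {y} p = ∧-true (G-edge p) (dec-true (IsEdge? a b x y) p)
      where
      G-edge : ∀ {x y} → IsEdge a b x y → Edge G x y
      G-edge (inj₁ (refl , refl)) = eab
      G-edge (inj₂ (refl , refl)) = edge-sym G eab

    edgeGraph-noEdgeAt : ∀ {z y} → z ≢ a → z ≢ b → ¬ Edge (edgeGraph a b) z y
    edgeGraph-noEdgeAt z≢a z≢b e with edgeGraph-edge⇒ e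
    ... | inj₁ (z≡a , _) = z≢a z≡a
    ... | inj₂ (z≡b , _) = z≢b z≡b

    edgeGraph-pendantˡ : Edge G a b → Pendant (edgeGraph a b) a
    edgeGraph-pendantˡ eab = b , edgeGraph-edge eab (inj₁ (refl , refl)) , unique
      where
      unique : ∀ y → Edge (edgeGraph a b) a y → y ≡ b
      unique y e with edgeGraph-edge⇒ e
      ... | inj₁ (_ , y≡b) = y≡b
      ... | inj₂ (a≡b , _) = ⊥-elim (edge⇒≢ G eab a≡b)

    edgeGraph-pendantʳ : Edge G a b → Pendant (edgeGraph a b) b
    edgeGraph-pendantʳ eab = a , edgeGraph-edge eab (inj₂ (refl , refl)) , unique
      where
      unique : ∀ y → Edge (edgeGraph a b) b y → y ≡ a
      unique y e with edgeGraph-edge⇒ e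
      ... | inj₁ (b≡a , _) = ⊥-elim (edge⇒≢ G eab (sym b≡a))
      ... | inj₂ (_ , y≡a) = y≡a

  edgeGraph-hubˡ : ∀ {a b} → Edge G a b → ∀ y → Edge (edgeGraph a b) a y → Pendant (edgeGraph a b) y
  edgeGraph-hubˡ eab y e with edgeGraph-edge⇒ e
  ... | inj₁ (_ , refl) = edgeGraph-pendantʳ eab
  ... | inj₂ (a≡b , _) = ⊥-elim (edge⇒≢ G eab a≡b)

  edgeGraph-hubʳ : ∀ {a b} → Edge G a b → ∀ y → Edge (edgeGraph a b) b y → Pendant (edgeGraph a b) y
  edgeGraph-hubʳ eab y e with edgeGraph-edge⇒ e
  ... | inj₁ (b≡a , _) = ⊥-elim (edge⇒≢ G eab (sym b≡a))
  ... | inj₂ (_ , refl) = edgeGraph-pendantˡ eab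

  record StarForest (H : Graph n) (U : Fin n → Set) : Set where
    field
      ⊆G : Subgraph H G
      support : ∀ u v → Edge H u v → U u
      covers : ∀ u → U u → NonIsolated H u
      pendantEnds : PendantEnds H

  open StarForest

  starForest⇒starFactor : ∀ {H U} → StarForest H U → (∀ u → U u) → IsStarFactor G H
  starForest⇒starFactor {H} F everywhere =
    locallyStar⇒starFactor G H (⊆G F) (λ v → covers F v (everywhere v)) (pendantEnds F)

  pendant-∪ˡ : ∀ (H₁ H₂ : Graph n) {z} → Pendant H₁ z → (∀ y → ¬ Edge H₂ z y) → Pendant (H₁ ∪ᴳ H₂) z
  pendant-∪ˡ H₁ H₂ {z} (t , et , unique) isolated₂ = t , ∨-trueˡ (adj H₂ z t) et , unique′
    where
    unique′ : ∀ y → Edge (H₁ ∪ᴳ H₂) z y → y ≡ t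
    unique′ y e with ∪-edge⇒ H₁ H₂ e
    ... | inj₁ e₁ = unique y e₁
    ... | inj₂ e₂ = ⊥-elim (isolated₂ y e₂)

  pendant-∪ʳ : ∀ (H₁ H₂ : Graph n) {z} → Pendant H₂ z → (∀ y → ¬ Edge H₁ z y) → Pendant (H₁ ∪ᴳ H₂) z
  pendant-∪ʳ H₁ H₂ {z} (t , et , unique) isolated₁ = t , ∨-trueʳ (adj H₁ z t) et , unique′
    where
    unique′ : ∀ y → Edge (H₁ ∪ᴳ H₂) z y → y ≡ t
    unique′ y e with ∪-edge⇒ H₁ H₂ e
    ... | inj₁ e₁ = ⊥-elim (isolated₁ y e₁)
    ... | inj₂ e₂ = unique y e₂

  Disjoint : (Fin n → Set) → (Fin n → Set) → Set
  Disjoint U₁ U₂ = ∀ u → U₁ u → U₂ u → ⊥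

  Disjoint-∪ : ∀ {U₁ U₂ V} → Disjoint U₁ V → Disjoint U₂ V → Disjoint (U₁ ∪ U₂) V
  Disjoint-∪ d₁ d₂ u (inj₁ x) = d₁ u x
  Disjoint-∪ d₁ d₂ u (inj₂ x) = d₂ u x

  Disjoint-⁅⁆ : ∀ {x V} → ¬ V x → Disjoint ⁅ x ⁆ V
  Disjoint-⁅⁆ x∉V u refl = x∉V

  Disjoint-⊆ˡ : ∀ {U U′ V} → (∀ {u} → U′ u → U u) → Disjoint U V → Disjoint U′ V
  Disjoint-⊆ˡ U′⊆U d u x y = d u (U′⊆U x) y

  Disjoint-⊆ʳ : ∀ {U V V′} → (∀ {u} → V′ u → V u) → Disjoint U V → Disjoint U V′
  Disjoint-⊆ʳ V′⊆V d u x y = d u x (V′⊆V y)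

  starForest-∪ : ∀ {H₁ H₂ U₁ U₂} → StarForest H₁ U₁ → StarForest H₂ U₂ → Disjoint U₁ U₂ →
                 StarForest (H₁ ∪ᴳ H₂) (U₁ ∪ U₂)
  starForest-∪ {H₁} {H₂} {U₁} {U₂} F₁ F₂ disjoint = record
    { ⊆G = λ u v e → [ ⊆G F₁ u v , ⊆G F₂ u v ]′ (∪-edge⇒ H₁ H₂ e)
    ; support = λ u v e → Data.Sum.map (support F₁ u v) (support F₂ u v) (∪-edge⇒ H₁ H₂ e)
    ; covers = covers′
    ; pendantEnds = pendantEnds′ }
    where
    covers′ : ∀ u → U₁ u ⊎ U₂ u → NonIsolated (H₁ ∪ᴳ H₂) u
    covers′ u (inj₁ x) with covers F₁ u x
    ... | t , e = t , ∨-trueˡ (adj H₂ u t) e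
    covers′ u (inj₂ x) with covers F₂ u x
    ... | t , e = t , ∨-trueʳ (adj H₁ u t) e
    isolated₂ : ∀ {z} → U₁ z → ∀ y → ¬ Edge H₂ z y
    isolated₂ z∈U₁ y e = disjoint _ z∈U₁ (support F₂ _ y e)
    isolated₁ : ∀ {z} → U₂ z → ∀ y → ¬ Edge H₁ z y
    isolated₁ z∈U₂ y e = disjoint _ (support F₁ _ y e) z∈U₂
    pendantEnds′ : PendantEnds (H₁ ∪ᴳ H₂)
    pendantEnds′ u v e with ∪-edge⇒ H₁ H₂ e
    ... | inj₁ e₁ = Data.Sum.map (λ p → pendant-∪ˡ H₁ H₂ p (isolated₂ (support F₁ u v e₁)))
                                 (λ p → pendant-∪ˡ H₁ H₂ p (isolated₂ (support F₁ v u (edge-sym H₁ e₁))))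
                                 (pendantEnds F₁ u v e₁)
    ... | inj₂ e₂ = Data.Sum.map (λ p → pendant-∪ʳ H₁ H₂ p (isolated₁ (support F₂ u v e₂)))
                                 (λ p → pendant-∪ʳ H₁ H₂ p (isolated₁ (support F₂ v u (edge-sym H₂ e₂))))
                                 (pendantEnds F₂ u v e₂)

  edgeGraph-starForest : ∀ {a b} → Edge G a b → StarForest (edgeGraph a b) (⁅ a ⁆ ∪ ⁅ b ⁆)
  edgeGraph-starForest {a} {b} eab = record
    { ⊆G = λ u v e → ∧-conicalˡ (adj G u v) _ e
    ; support = λ u v e → Data.Sum.map proj₁ proj₁ (edgeGraph-edge⇒ e)
    ; covers = λ { u (inj₁ refl) → b , edgeGraph-edge eab (inj₁ (refl , refl))
                 ; u (inj₂ refl) → a , edgeGraph-edge eab (inj₂ (refl , refl)) }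
    ; pendantEnds = λ u v e → inj₁ (endpoint-pendant (edgeGraph-edge⇒ e)) }
    where
    endpoint-pendant : ∀ {u v} → IsEdge a b u v → Pendant (edgeGraph a b) u
    endpoint-pendant (inj₁ (refl , _)) = edgeGraph-pendantˡ eab
    endpoint-pendant (inj₂ (refl , _)) = edgeGraph-pendantʳ eab

  starForest-attach : ∀ {A U c s} → StarForest A U → ¬ U c → U s → Edge G c s →
                      (∀ y → Edge A s y → Pendant A y) → StarForest (edgeGraph c s ∪ᴳ A) (U ∪ ⁅ c ⁆)
  starForest-attach {A} {U} {c} {s} F c∉U s∈U ecs s-hub = record
    { ⊆G = ⊆G′ ; support = support′ ; covers = covers′ ; pendantEnds = pendantEnds′ }
    where
    E : Graph n
    E = edgeGraph c s
    ⊆G′ : Subgraph (E ∪ᴳ A) G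
    ⊆G′ u v e with ∪-edge⇒ E A e
    ... | inj₁ e₁ = ∧-conicalˡ (adj G u v) _ e₁
    ... | inj₂ e₂ = ⊆G F u v e₂
    support′ : ∀ u v → Edge (E ∪ᴳ A) u v → U u ⊎ u ≡ c
    support′ u v e with ∪-edge⇒ E A e
    ... | inj₂ e₂ = inj₁ (support F u v e₂)
    ... | inj₁ e₁ with edgeGraph-edge⇒ e₁
    ...   | inj₁ (u≡c , _) = inj₂ u≡c
    ...   | inj₂ (refl , _) = inj₁ s∈U
    covers′ : ∀ u → U u ⊎ u ≡ c → NonIsolated (E ∪ᴳ A) u
    covers′ u (inj₁ u∈U) with covers F u u∈U
    ... | t , e = t , ∨-trueʳ (adj E u t) e
    covers′ u (inj₂ refl) = s , ∨-trueˡ (adj A c s) (edgeGraph-edge ecs (inj₁ (refl , refl)))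
    c-pendant : Pendant (E ∪ᴳ A) c
    c-pendant = pendant-∪ˡ E A (edgeGraph-pendantˡ ecs) (λ y e → c∉U (support F c y e))
    lift : ∀ {x} → Pendant A x → U x → x ≢ s → Pendant (E ∪ᴳ A) x
    lift p x∈U x≢s = pendant-∪ʳ E A p (λ y → edgeGraph-noEdgeAt (λ { refl → c∉U x∈U }) x≢s)
    A-pendantEnds : ∀ u v → Edge A u v → Dec (u ≡ s) → Dec (v ≡ s) → Pendant (E ∪ᴳ A) u ⊎ Pendant (E ∪ᴳ A) v
    A-pendantEnds u v e (yes refl) _ = inj₂ (lift (s-hub v e) (support F v u (edge-sym A e)) (edge⇒≢ A (edge-sym A e)))
    A-pendantEnds u v e (no u≢s) (yes refl) = inj₁ (lift (s-hub u (edge-sym A e)) (support F u v e) u≢s)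
    A-pendantEnds u v e (no u≢s) (no v≢s) =
      Data.Sum.map (λ p → lift p (support F u v e) u≢s) (λ p → lift p (support F v u (edge-sym A e)) v≢s)
                   (pendantEnds F u v e)
    pendantEnds′ : PendantEnds (E ∪ᴳ A)
    pendantEnds′ u v e with ∪-edge⇒ E A e
    ... | inj₂ e₂ = A-pendantEnds u v e₂ (u ≟F s) (v ≟F s)
    ... | inj₁ e₁ with edgeGraph-edge⇒ e₁
    ...   | inj₁ (refl , refl) = inj₁ c-pendant
    ...   | inj₂ (refl , refl) = inj₂ c-pendant

  weight-∪ : ∀ (w : Weighting n) (H₁ H₂ : Graph n) → (∀ u v → Edge H₁ u v → ¬ Edge H₂ u v) →
             weight w (H₁ ∪ᴳ H₂) ≡ weight w H₁ + weight w H₂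
  weight-∪ w H₁ H₂ disjoint = begin
    weight w (H₁ ∪ᴳ H₂)                                    ≡⟨ weight≡∑∑ w (H₁ ∪ᴳ H₂) ⟩
    ∑ (λ u → ∑ (edgeTerm w (H₁ ∪ᴳ H₂) u))                  ≡⟨ sum-cong-≗ splitRow ⟩
    ∑ (λ u → ∑ (row₁ u) + ∑ (row₂ u))                      ≡⟨ ∑-distrib-+ (λ u → ∑ (row₁ u)) (λ u → ∑ (row₂ u)) ⟩
    ∑ (λ u → ∑ (row₁ u)) + ∑ (λ u → ∑ (row₂ u))            ≡⟨ cong₂ _+_ (weight≡∑∑ w H₁) (weight≡∑∑ w H₂) ⟨
    weight w H₁ + weight w H₂                              ∎
    where
    open ≡-Reasoning
    row₁ row₂ : Fin n → Fin n → ℕ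
    row₁ = edgeTerm w H₁
    row₂ = edgeTerm w H₂
    term-∪ : ∀ u v → edgeTerm w (H₁ ∪ᴳ H₂) u v ≡ edgeTerm w H₁ u v + edgeTerm w H₂ u v
    term-∪ u v with adj H₁ u v in e₁ | adj H₂ u v in e₂
    ... | true | true = ⊥-elim (disjoint u v e₁ e₂)
    ... | true | false = sym (+-identityʳ _)
    ... | false | _ = refl
    splitRow : ∀ u → ∑ (edgeTerm w (H₁ ∪ᴳ H₂) u) ≡ ∑ (row₁ u) + ∑ (row₂ u)
    splitRow u = trans (sum-cong-≗ (term-∪ u)) (∑-distrib-+ (row₁ u) (row₂ u))

  weight-attach : ∀ (w : Weighting n) {A U c s} → StarForest A U → ¬ U c →
                  weight w (edgeGraph c s ∪ᴳ A) ≡ weight w (edgeGraph c s) + weight w A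
  weight-attach w {A} {c = c} {s} F c∉U = weight-∪ w (edgeGraph c s) A disjoint
    where
    disjoint : ∀ u v → Edge (edgeGraph c s) u v → ¬ Edge A u v
    disjoint u v e eA with edgeGraph-edge⇒ e
    ... | inj₁ (refl , _) = c∉U (support F u v eA)
    ... | inj₂ (_ , refl) = c∉U (support F v u (edge-sym A eA))

  weight-∪-starForests : ∀ (w : Weighting n) {H₁ H₂ U₁ U₂} → StarForest H₁ U₁ → StarForest H₂ U₂ → Disjoint U₁ U₂ →
                         weight w (H₁ ∪ᴳ H₂) ≡ weight w H₁ + weight w H₂
  weight-∪-starForests w {H₁} {H₂} F₁ F₂ disjoint =
    weight-∪ w H₁ H₂ (λ u v e₁ e₂ → disjoint u (support F₁ u v e₁) (support F₂ u v e₂))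

  weight-edgeGraph-positive : ∀ (w : Weighting n) → PositiveWeighting G w → ∀ {a b} → Edge G a b →
                              1 ≤ weight w (edgeGraph a b)
  weight-edgeGraph-positive w positive {a} {b} eab = subst (1 ≤_) (sym (weight≡∑∑ w E)) (edgeTerm-positive (<-cmp a b))
    where
    E : Graph n
    E = edgeGraph a b
    term≤∑∑ : ∀ {x y} → IsEdge a b x y → x Data.Fin.< y → Edge G x y → 1 ≤ ∑ (λ u → ∑ (edgeTerm w E u))
    term≤∑∑ {x} {y} xy∈E x<y exy =
      ≤-trans 1≤term (≤-trans (term≤∑ (edgeTerm w E x) y) (term≤∑ (λ u → ∑ (edgeTerm w E u)) x))
      where
      1≤term : 1 ≤ edgeTerm w E x y
      1≤term rewrite edgeGraph-edge eab xy∈E | dec-true (x <? y) x<y = positive x y exy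
    edgeTerm-positive : Tri (a Data.Fin.< b) (a ≡ b) (b Data.Fin.< a) → 1 ≤ ∑ (λ u → ∑ (edgeTerm w E u))
    edgeTerm-positive (tri< a<b _ _) = term≤∑∑ (inj₁ (refl , refl)) a<b eab
    edgeTerm-positive (tri≈ _ a≡b _) = ⊥-elim (edge⇒≢ G eab a≡b)
    edgeTerm-positive (tri> _ _ b<a) = term≤∑∑ (inj₂ (refl , refl)) b<a (edge-sym G eab)

  record Cover (K : Graph n) (U : Fin n → Set) : Set where
    field
      ⊆G : Subgraph K G
      support : ∀ u v → Edge K u v → U u
      covers : ∀ u → U u → NonIsolated K u

  degreeSum : Graph n → ℕ
  degreeSum K = ∑ (λ x → count (adj K x))

  deleteEdge : Graph n → Fin n → Fin n → Graph n
  deleteEdge K u v = keepEdges K (λ x y → not (does (IsEdge? u v x y))) (λ x y → cong not (IsEdge?-sym u v x y))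

  module _ {K : Graph n} {u v : Fin n} where
    deleteEdge-⊆ : ∀ {x y} → Edge (deleteEdge K u v) x y → Edge K x y
    deleteEdge-⊆ {x} {y} e = ∧-conicalˡ (adj K x y) _ e

    deleteEdge-keeps : ∀ {x y} → Edge K x y → ¬ IsEdge u v x y → Edge (deleteEdge K u v) x y
    deleteEdge-keeps {x} {y} e other = ∧-true e (cong not (dec-false (IsEdge? u v x y) other))

    deleteEdge-degreeSum< : Edge K u v → degreeSum (deleteEdge K u v) < degreeSum K
    deleteEdge-degreeSum< euv =
      ∑-mono-< (λ x → count-mono (λ y → deleteEdge-⊆ {x} {y})) u
               (count-mono-< (λ y → deleteEdge-⊆ {u} {y}) v uv-deleted euv)
      where
      uv-deleted : adj (deleteEdge K u v) u v ≡ false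
      uv-deleted rewrite dec-true (IsEdge? u v u v) (inj₁ (refl , refl)) = ∧-zeroʳ (adj K u v)

  anotherNeighbour : ∀ (K : Graph n) {u v} → Edge K u v → ¬ Pendant K u → Σ (Fin n) λ t → Edge K u t × t ≢ v
  anotherNeighbour K {u} {v} euv ¬pendant
    with ¬∀⟶∃¬ n (λ t → Edge K u t → t ≡ v) (λ t → Edge? K u t →-dec (t ≟F v)) (λ only-v → ¬pendant (v , euv , only-v))
  ... | t , ¬[eut⇒t≡v] with Edge? K u t
  ...   | yes eut = t , eut , (λ t≡v → ¬[eut⇒t≡v] (λ _ → t≡v))
  ...   | no ¬eut = ⊥-elim (¬[eut⇒t≡v] (λ eut → ⊥-elim (¬eut eut)))

  BadEdge : Graph n → Fin n → Fin n → Set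
  BadEdge K u v = Edge K u v × ¬ Pendant K u × ¬ Pendant K v

  BadEdge? : ∀ K u v → Dec (BadEdge K u v)
  BadEdge? K u v = Edge? K u v ×-dec (¬? (Pendant? K u) ×-dec ¬? (Pendant? K v))

  module _ {U : Fin n → Set} where
    deleteBadEdge-cover : ∀ {K u v} → Cover K U → BadEdge K u v → Cover (deleteEdge K u v) U
    deleteBadEdge-cover {K} {u} {v} C (euv , ¬pu , ¬pv) = record
      { ⊆G = λ x y e → Cover.⊆G C x y (deleteEdge-⊆ {K} e)
      ; support = λ x y e → Cover.support C x y (deleteEdge-⊆ {K} e)
      ; covers = λ x x∈U → covers′ x x∈U (x ≟F u) (x ≟F v) }
      where
      covers′ : ∀ x → U x → Dec (x ≡ u) → Dec (x ≡ v) → NonIsolated (deleteEdge K u v) x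
      covers′ x _ (yes refl) _ with anotherNeighbour K euv ¬pu
      ... | t , eut , t≢v =
        t , deleteEdge-keeps {K} eut λ { (inj₁ (_ , t≡v)) → t≢v t≡v ; (inj₂ (u≡v , _)) → edge⇒≢ K euv u≡v }
      covers′ x _ (no _) (yes refl) with anotherNeighbour K (edge-sym K euv) ¬pv
      ... | t , evt , t≢u =
        t , deleteEdge-keeps {K} evt λ { (inj₁ (v≡u , _)) → edge⇒≢ K euv (sym v≡u) ; (inj₂ (_ , t≡u)) → t≢u t≡u }
      covers′ x x∈U (no x≢u) (no x≢v) with Cover.covers C x x∈U
      ... | t , ext = t , deleteEdge-keeps {K} ext λ { (inj₁ (x≡u , _)) → x≢u x≡u ; (inj₂ (x≡v , _)) → x≢v x≡v }

    cover⇒starForest : (fuel : ℕ) (K : Graph n) → degreeSum K ≤ fuel → Cover K U → Σ (Graph n) λ H → StarForest H U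
    cover⇒starForest fuel K bound C with any? (λ u → any? (λ v → BadEdge? K u v))
    ... | no ¬bad = K , record { ⊆G = Cover.⊆G C ; support = Cover.support C ; covers = Cover.covers C ; pendantEnds = ends }
      where
      ends : PendantEnds K
      ends u v euv with Pendant? K u | Pendant? K v
      ... | yes pu | _ = inj₁ pu
      ... | no _ | yes pv = inj₂ pv
      ... | no ¬pu | no ¬pv = ⊥-elim (¬bad (u , v , euv , ¬pu , ¬pv))
    cover⇒starForest zero K bound C | yes (u , v , bad) = ⊥-elim (n≮0 (≤-trans (deleteEdge-degreeSum< {K} (proj₁ bad)) bound))
    cover⇒starForest (suc fuel) K bound C | yes (u , v , bad) =
      cover⇒starForest fuel (deleteEdge K u v) (≤-pred (≤-trans (deleteEdge-degreeSum< {K} (proj₁ bad)) bound))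
                       (deleteBadEdge-cover C bad)

    starForest-exists : (∀ u → Dec (U u)) → (∀ u → U u → Σ (Fin n) λ t → Edge G u t × U t) →
                        Σ (Graph n) λ H → StarForest H U
    starForest-exists U? neighbourIn = cover⇒starForest (degreeSum G[U]) G[U] ≤-refl record
      { ⊆G = λ u v e → ∧-conicalˡ (adj G u v) _ e
      ; support = λ u v e → does⇒ (U? u) (∧-conicalˡ (does (U? u)) _ (∧-conicalʳ (adj G u v) _ e))
      ; covers = covers-U }
      where
      G[U] : Graph n
      G[U] = keepEdges G (λ u v → does (U? u) ∧ does (U? v)) (λ u v → ∧-comm (does (U? u)) (does (U? v)))
      covers-U : ∀ u → U u → NonIsolated G[U] u
      covers-U u u∈U with neighbourIn u u∈U
      ... | t , eut , t∈U = t , ∧-true eut (∧-true (dec-true (U? u) u∈U) (dec-true (U? t) t∈U))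

-- Trees

¬¬-decidable : ∀ {n} (P : Fin n → Set) → ¬ ¬ (∀ x → Dec (P x))
¬¬-decidable {zero} P ¬dec = ¬dec (λ ())
¬¬-decidable {suc n} P ¬dec = ¬¬-decidable (λ x → P (suc x)) λ dec-suc →
  ¬¬-dec₀ (λ dec-zero → ¬dec (λ { zero → dec-zero ; (suc x) → dec-suc x }))
  where
  ¬¬-dec₀ : ¬ ¬ Dec (P zero)
  ¬¬-dec₀ ¬dec₀ = ¬dec₀ (no (λ p → ¬dec₀ (yes p)))

All≢⇒lookup≢ : ∀ {n} {x : Fin n} {ys} → All (x ≢_) ys → ∀ j → x ≢ lookup ys j
All≢⇒lookup≢ (p ∷ _) zero = p
All≢⇒lookup≢ (_ ∷ ps) (suc j) = All≢⇒lookup≢ ps j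

lookup-injective : ∀ {n} (xs : List (Fin n)) → AllPairs _≢_ xs → Injective _≡_ _≡_ (lookup xs)
lookup-injective (x ∷ xs) (x∉ ∷ distinct) {zero} {zero} eq = refl
lookup-injective (x ∷ xs) (x∉ ∷ distinct) {zero} {suc j} eq = ⊥-elim (All≢⇒lookup≢ x∉ j eq)
lookup-injective (x ∷ xs) (x∉ ∷ distinct) {suc i} {zero} eq = ⊥-elim (All≢⇒lookup≢ x∉ i (sym eq))
lookup-injective (x ∷ xs) (x∉ ∷ distinct) {suc i} {suc j} eq = cong suc (lookup-injective xs distinct eq)

module Paths {n : ℕ} (G : Graph n) where
  open DecMembership (_≟F_ {n}) using (_∈?_)

  Avoiding : Fin n → Fin n → Fin n → Set
  Avoiding z u v = Edge G u v × u ≢ z × v ≢ z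

  Avoiding-sym : ∀ {z x y} → Avoiding z x y → Avoiding z y x
  Avoiding-sym (e , x≢z , y≢z) = edge-sym G e , y≢z , x≢z

  Reach-avoids : ∀ {z x u} → x ≢ z → Reach (Avoiding z) x u → u ≢ z
  Reach-avoids x≢z here = x≢z
  Reach-avoids x≢z (step (_ , _ , v≢z) r) = Reach-avoids v≢z r

  module _ (R : Fin n → Fin n → Set) where
    Chain : Fin n → List (Fin n) → Set
    Chain x [] = ⊤
    Chain x (v ∷ vs) = R x v × Chain v vs

    EndsAt : Fin n → List (Fin n) → Fin n → Set
    EndsAt x [] y = x ≡ y
    EndsAt x (v ∷ vs) y = EndsAt v vs y

    SimplePath : Fin n → Fin n → Set
    SimplePath x y = Σ (List (Fin n)) λ vs → Chain x vs × AllPairs _≢_ (x ∷ vs) × EndsAt x vs y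

    suffixFrom : ∀ {y} x v vs → x ∈ (v ∷ vs) → Chain v vs → AllPairs _≢_ (v ∷ vs) → EndsAt v vs y → SimplePath x y
    suffixFrom x v vs (here refl) chain distinct end = vs , chain , distinct , end
    suffixFrom x v (v′ ∷ vs) (there x∈) (_ , chain) (_ ∷ distinct) end = suffixFrom x v′ vs x∈ chain distinct end

    simplePath : ∀ {x y} → Reach R x y → SimplePath x y
    simplePath here = [] , tt , [] ∷ [] , refl
    simplePath {x} (step {v = v} r rest) with simplePath rest
    ... | vs , chain , distinct , end with x ∈? (v ∷ vs)
    ...   | yes x∈ = suffixFrom x v vs x∈ chain distinct end
    ...   | no x∉ = v ∷ vs , (r , chain) , ¬Any⇒All¬ (v ∷ vs) x∉ ∷ distinct , end

    lookup-last : ∀ {y} x vs → EndsAt x vs y → lookup (x ∷ vs) (fromℕ (length vs)) ≡ y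
    lookup-last x [] end = end
    lookup-last x (v ∷ vs) end = lookup-last v vs end

  Chain-avoids : ∀ {z x} vs → Chain (Avoiding z) x vs → All (_≢ z) vs
  Chain-avoids [] _ = []
  Chain-avoids (v ∷ vs) ((_ , _ , v≢z) , chain) = v≢z ∷ Chain-avoids vs chain

  Chain-edges : ∀ {z x} vs → Chain (Avoiding z) x vs → Chain (Edge G) x vs
  Chain-edges [] _ = tt
  Chain-edges (v ∷ vs) ((e , _) , chain) = e , Chain-edges vs chain

  lookup-Chain : ∀ a b vs → Chain (Edge G) a (b ∷ vs) → (i : Fin (suc (length vs))) →
                 Edge G (lookup (a ∷ b ∷ vs) (inject₁ i)) (lookup (b ∷ vs) i)
  lookup-Chain a b vs (e , _) zero = e
  lookup-Chain a b (c ∷ vs) (_ , chain) (suc i) = lookup-Chain b c vs chain i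

  detour⇒cycle : ∀ {z x y} → x ≢ y → Reach (Avoiding z) x y → Edge G z x → Edge G z y → HasCycle G
  detour⇒cycle {z} {x} {y} x≢y r ezx ezy with simplePath (Avoiding z) r
  ... | [] , _ , _ , x≡y = ⊥-elim (x≢y x≡y)
  ... | v ∷ vs , chain , distinct , end = length vs , lookup cycle , lookup-injective cycle cycle-distinct ,
                                         lookup-Chain z x (v ∷ vs) (ezx , Chain-edges (v ∷ vs) chain) , closing
    where
    cycle : List (Fin n)
    cycle = z ∷ x ∷ v ∷ vs
    cycle-distinct : AllPairs _≢_ cycle
    cycle-distinct =
      All-map (λ u≢z z≡u → u≢z (sym z≡u)) (proj₁ (proj₂ (proj₁ chain)) ∷ Chain-avoids (v ∷ vs) chain) ∷ distinct
    closing : Edge G (lookup cycle (fromℕ (suc (suc (length vs))))) z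
    closing = subst (λ t → Edge G t z) (sym (lookup-last (Avoiding z) z (x ∷ v ∷ vs) end)) (edge-sym G ezy)

  acyclic⇒noDetour : ¬ HasCycle G → ∀ {z x y} → x ≢ y → Reach (Avoiding z) x y → Edge G z x → Edge G z y → ⊥
  acyclic⇒noDetour acyclic x≢y r ezx ezy = acyclic (detour⇒cycle x≢y r ezx ezy)

module TreeFacts {n : ℕ} (G : Graph n) (tree : IsTree G) where
  open Classification G
  open Paths G

  private
    connected : Connected G
    connected = proj₁ (proj₂ tree)
    acyclic : ¬ HasCycle G
    acyclic = proj₂ (proj₂ tree)

  distinct⇒nonIsolated : ∀ {u v} → u ≢ v → NonIsolated G u
  distinct⇒nonIsolated {u} {v} u≢v with connected u v
  ... | here = ⊥-elim (u≢v refl)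
  ... | step e _ = _ , e

  -- If every neighbour of u lay in X, then, X being connected in G − u, acyclicity would leave u a
  -- single neighbour, which would then be a stem.
  escape : ∀ {u x₀ v} {X : Fin n → Set} → (∀ t → Dec (X t)) → u ≢ v →
           (∀ {t} → X t → Reach (Avoiding u) x₀ t × Remaining G t) → Σ (Fin n) λ t → Edge G u t × ¬ X t
  escape {u} {x₀} {X = X} X? u≢v inX with ¬∀⟶∃¬ n (λ t → Edge G u t → X t) (λ t → Edge? G u t →-dec X? t) allIn
    where
    allIn : ¬ (∀ t → Edge G u t → X t)
    allIn neighbours⊆X with distinct⇒nonIsolated u≢v
    ... | t , eut = proj₂ (proj₂ (inX (neighbours⊆X t eut))) (onlyNeighbour⇒stem eut only-t)
      where
      only-t : ∀ t′ → Edge G u t′ → t′ ≡ t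
      only-t t′ eut′ with t′ ≟F t
      ... | yes eq = eq
      ... | no t′≢t = ⊥-elim (acyclic⇒noDetour acyclic t′≢t
                                (Reach-trans (Reach-sym Avoiding-sym (proj₁ (inX (neighbours⊆X t′ eut′))))
                                             (proj₁ (inX (neighbours⊆X t eut))))
                                eut′ eut)
  ... | t , ¬[eut⇒X] with Edge? G u t
  ...   | yes eut = t , eut , (λ x → ¬[eut⇒X] (λ _ → x))
  ...   | no ¬eut = ⊥-elim (¬[eut⇒X] (λ eut → ⊥-elim (¬eut eut)))

-- Constant weightings exclude two configurations

equalSums⇒zero : ∀ {x₁ x₂ x₃ x₄ e} → x₂ ≡ x₁ → x₃ ≡ x₁ → x₄ ≡ x₁ → x₁ + x₂ + e ≡ x₃ + x₄ → e ≡ 0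
equalSums⇒zero {x₁} {e = e} refl refl refl sums = +-cancelˡ-≡ (x₁ + x₁) e 0 (trans sums (sym (+-identityʳ (x₁ + x₁))))

module Forward {n : ℕ} (G : Graph n) (tree : IsTree G) (Ω : InΩ G) where
  open Classification G
  open Paths G
  open StarForests G
  open TreeFacts G tree

  private
    w : Weighting n
    w = proj₁ Ω
    positive : PositiveWeighting G w
    positive = proj₁ (proj₂ Ω)
    balanced : ∀ H₁ H₂ → IsStarFactor G H₁ → IsStarFactor G H₂ → weight w H₁ ≡ weight w H₂
    balanced = proj₂ (proj₂ Ω)
    acyclic : ¬ HasCycle G
    acyclic = proj₂ (proj₂ tree)

  W : Graph n → ℕ
  W = weight w

  edgeWeight≢0 : ∀ {a b} → Edge G a b → W (edgeGraph a b) ≢ 0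
  edgeWeight≢0 eab W≡0 = <-irrefl (sym W≡0) (weight-edgeGraph-positive w positive eab)

  equalWeights⇒zero : ∀ {H₁ H₂ H₃ H₄ e} → IsStarFactor G H₁ → IsStarFactor G H₂ → IsStarFactor G H₃ → IsStarFactor G H₄ →
                      W H₁ + W H₂ + e ≡ W H₃ + W H₄ → e ≡ 0
  equalWeights⇒zero {H₁} {H₂} {H₃} {H₄} F₁ F₂ F₃ F₄ =
    equalSums⇒zero (balanced H₂ H₁ F₂ F₁) (balanced H₃ H₁ F₃ F₁) (balanced H₄ H₁ F₄ F₁)

  starForest-stemHub : ∀ {H U s ℓ} → StarForest H U → U ℓ → IsLeaf G ℓ → Edge G s ℓ →
                       ∀ y → Edge H s y → Pendant H y
  starForest-stemHub {H} {s = s} {ℓ} F ℓ∈U leaf esℓ y esy with leaf⇒pendant leaf | StarForest.covers F ℓ ℓ∈U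
  ... | s′ , _ , only-s′ | z , eℓz with StarForest.pendantEnds F s y esy
  ...   | inj₂ py = py
  ...   | inj₁ (t , _ , only-t) = subst (Pendant H) (trans (only-t ℓ (edge-sym H eℓs)) (sym (only-t y esy))) ℓ-pendant
    where
    z≡s : z ≡ s
    z≡s = trans (only-s′ z (StarForest.⊆G F ℓ z eℓz)) (sym (only-s′ s (edge-sym G esℓ)))
    eℓs : Edge H ℓ s
    eℓs = subst (Edge H ℓ) z≡s eℓz
    ℓ-pendant : Pendant H ℓ
    ℓ-pendant = s , eℓs , λ y′ eℓy′ → trans (only-s′ y′ (StarForest.⊆G F ℓ y′ eℓy′)) (sym (only-s′ s (edge-sym G esℓ)))

  module Branch {z x : Fin n} (rz : Remaining G z) (rx : Remaining G x) (exz : Edge G x z)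
                (B? : ∀ u → Dec (Reach (Avoiding z) x u)) where
    B B′ : Fin n → Set
    B u = Reach (Avoiding z) x u
    B′ u = B u × u ≢ x

    B′? : ∀ u → Dec (B′ u)
    B′? u = B? u ×-dec ¬? (u ≟F x)

    B⇒≢z : ∀ {u} → B u → u ≢ z
    B⇒≢z = Reach-avoids (edge⇒≢ G exz)

    B-closed : ∀ {u t} → B u → Edge G u t → t ≢ z → B t
    B-closed bu eut t≢z = Reach-snoc bu (eut , B⇒≢z bu , t≢z)

    z∉B : ¬ B z
    z∉B bz = B⇒≢z bz refl

    x∉B′ : ¬ B′ x
    x∉B′ (_ , x≢x) = x≢x refl

    neighbour∉B : ∀ {y} → y ≢ x → Edge G z y → ¬ B y
    neighbour∉B y≢x ezy by = acyclic⇒noDetour acyclic (≢-sym y≢x) by (edge-sym G exz) ezy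

    B-covered : ∀ u → B u → Σ (Fin n) λ t → Edge G u t × B t
    B-covered u bu with escape {x₀ = z} (_≟F z) (B⇒≢z bu) (λ { refl → here , rz })
    ... | t , eut , t≢z = t , eut , B-closed bu eut t≢z

    B′-covered : ∀ u → B′ u → Σ (Fin n) λ t → Edge G u t × B′ t
    B′-covered u (bu , u≢x) with escape {x₀ = x} (λ t → (t ≟F x) ⊎-dec (t ≟F z)) u≢x
                                        (λ { (inj₁ refl) → here , rx
                                           ; (inj₂ refl) → step (exz , ≢-sym u≢x , ≢-sym (B⇒≢z bu)) here , rz })
    ... | t , eut , t∉ = t , eut , B-closed bu eut (λ t≡z → t∉ (inj₂ t≡z)) , (λ t≡x → t∉ (inj₁ t≡x))

    HB HB′ : Graph n
    HB = proj₁ (starForest-exists B? B-covered)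
    HB′ = proj₁ (starForest-exists B′? B′-covered)

    FB : StarForest HB B
    FB = proj₂ (starForest-exists B? B-covered)

    FB′ : StarForest HB′ B′
    FB′ = proj₂ (starForest-exists B′? B′-covered)

  module RemainingPath {a b c d : Fin n} (ra : Remaining G a) (rb : Remaining G b) (rc : Remaining G c)
                       (rd : Remaining G d) (eab : Edge G a b) (ebc : Edge G b c) (ecd : Edge G c d)
                       (a≢c : a ≢ c) (b≢d : b ≢ d) (S? : ∀ u → Dec (Reach (Avoiding b) a u)) where
    open Branch rb ra eab S? using ()
      renaming (B to S; B′ to S′; B⇒≢z to S⇒≢b; B-closed to S-closed; z∉B to b∉S; x∉B′ to a∉S′;
                HB to HS; HB′ to HS′; FB to FS; FB′ to FS′)

    a≢b : a ≢ b
    a≢b = edge⇒≢ G eab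
    b≢c : b ≢ c
    b≢c = edge⇒≢ G ebc
    c≢d : c ≢ d
    c≢d = edge⇒≢ G ecd

    c∉S : ¬ S c
    c∉S = Branch.neighbour∉B rb ra eab S? (≢-sym a≢c) ebc

    d∉S : ¬ S d
    d∉S sd = c∉S (S-closed sd (edge-sym G ecd) (≢-sym b≢c))

    -- S is the branch of G − b containing a, and T everything beyond c.
    T T′ : Fin n → Set
    T u = ¬ S u × u ≢ b × u ≢ c
    T′ u = T u × u ≢ d

    T? : ∀ u → Dec (T u)
    T? u = ¬? (S? u) ×-dec (¬? (u ≟F b) ×-dec ¬? (u ≟F c))

    T′? : ∀ u → Dec (T′ u)
    T′? u = T? u ×-dec ¬? (u ≟F d)

    T-covered : ∀ u → T u → Σ (Fin n) λ t → Edge G u t × T t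
    T-covered u (u∉S , u≢b , u≢c) with escape {x₀ = b} (λ t → (t ≟F b) ⊎-dec (t ≟F c)) u≢b
                                                (λ { (inj₁ refl) → here , rb
                                                   ; (inj₂ refl) → step (ebc , ≢-sym u≢b , ≢-sym u≢c) here , rc })
    ... | t , eut , t∉ = t , eut , (λ st → u∉S (S-closed st (edge-sym G eut) u≢b)) , (λ t≡b → t∉ (inj₁ t≡b)) ,
                         (λ t≡c → t∉ (inj₂ t≡c))

    T′-covered : ∀ u → T′ u → Σ (Fin n) λ t → Edge G u t × T′ t
    T′-covered u ((u∉S , u≢b , u≢c) , u≢d)
      with escape {x₀ = b} (λ t → (t ≟F b) ⊎-dec ((t ≟F c) ⊎-dec (t ≟F d))) u≢b
                  (λ { (inj₁ refl) → here , rb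
                     ; (inj₂ (inj₁ refl)) → step (ebc , ≢-sym u≢b , ≢-sym u≢c) here , rc
                     ; (inj₂ (inj₂ refl)) → step (ebc , ≢-sym u≢b , ≢-sym u≢c) (step (ecd , ≢-sym u≢c , ≢-sym u≢d) here) , rd })
    ... | t , eut , t∉ = t , eut , ((λ st → u∉S (S-closed st (edge-sym G eut) u≢b)) , (λ t≡b → t∉ (inj₁ t≡b)) ,
                                    (λ t≡c → t∉ (inj₂ (inj₁ t≡c)))) , (λ t≡d → t∉ (inj₂ (inj₂ t≡d)))

    HT HT′ : Graph n
    HT = proj₁ (starForest-exists T? T-covered)
    HT′ = proj₁ (starForest-exists T′? T′-covered)

    FT : StarForest HT T
    FT = proj₂ (starForest-exists T? T-covered)

    FT′ : StarForest HT′ T′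
    FT′ = proj₂ (starForest-exists T′? T′-covered)

    a∉T : ¬ T a
    a∉T (a∉S , _) = a∉S here
    b∉T : ¬ T b
    b∉T (_ , b≢b , _) = b≢b refl
    c∉T : ¬ T c
    c∉T (_ , _ , c≢c) = c≢c refl
    d∉T′ : ¬ T′ d
    d∉T′ (_ , d≢d) = d≢d refl
    a∉bc : ¬ (⁅ b ⁆ ∪ ⁅ c ⁆) a
    a∉bc (inj₁ a≡b) = a≢b a≡b
    a∉bc (inj₂ a≡c) = a≢c a≡c
    d∉bc : ¬ (⁅ b ⁆ ∪ ⁅ c ⁆) d
    d∉bc (inj₁ d≡b) = b≢d (sym d≡b)
    d∉bc (inj₂ d≡c) = c≢d (sym d≡c)

    S∩T : Disjoint S T
    S∩T u su (u∉S , _) = u∉S su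
    bc∩S : Disjoint (⁅ b ⁆ ∪ ⁅ c ⁆) S
    bc∩S = Disjoint-∪ (Disjoint-⁅⁆ b∉S) (Disjoint-⁅⁆ c∉S)
    bc∩T : Disjoint (⁅ b ⁆ ∪ ⁅ c ⁆) T
    bc∩T = Disjoint-∪ (Disjoint-⁅⁆ b∉T) (Disjoint-⁅⁆ c∉T)

    Eab Ebc Edc : Graph n
    Eab = edgeGraph a b
    Ebc = edgeGraph b c
    Edc = edgeGraph d c

    H₁ H₂ H₃ H₄ : Graph n
    H₁ = Ebc ∪ᴳ HS ∪ᴳ HT
    H₂ = Eab ∪ᴳ Ebc ∪ᴳ HS′ ∪ᴳ HT
    H₃ = Edc ∪ᴳ Ebc ∪ᴳ HS ∪ᴳ HT′
    H₄ = Eab ∪ᴳ Edc ∪ᴳ HS′ ∪ᴳ HT′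

    Fbc : StarForest Ebc (⁅ b ⁆ ∪ ⁅ c ⁆)
    Fbc = edgeGraph-starForest ebc

    Fabc : StarForest (Eab ∪ᴳ Ebc) (⁅ b ⁆ ∪ ⁅ c ⁆ ∪ ⁅ a ⁆)
    Fabc = starForest-attach Fbc a∉bc (inj₁ refl) eab (edgeGraph-hubˡ ebc)

    Fdcb : StarForest (Edc ∪ᴳ Ebc) (⁅ b ⁆ ∪ ⁅ c ⁆ ∪ ⁅ d ⁆)
    Fdcb = starForest-attach Fbc d∉bc (inj₂ refl) (edge-sym G ecd) (edgeGraph-hubʳ ebc)

    ab∩dc : Disjoint (⁅ a ⁆ ∪ ⁅ b ⁆) (⁅ d ⁆ ∪ ⁅ c ⁆)
    ab∩dc = Disjoint-∪ (Disjoint-⁅⁆ λ { (inj₁ a≡d) → d∉S (subst S a≡d here) ; (inj₂ a≡c) → a≢c a≡c })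
                       (Disjoint-⁅⁆ λ { (inj₁ b≡d) → b≢d b≡d ; (inj₂ b≡c) → b≢c b≡c })
    bcS∩T : Disjoint (⁅ b ⁆ ∪ ⁅ c ⁆ ∪ S) T
    bcS∩T = Disjoint-∪ bc∩T S∩T
    bca∩S′ : Disjoint (⁅ b ⁆ ∪ ⁅ c ⁆ ∪ ⁅ a ⁆) S′
    bca∩S′ = Disjoint-∪ (Disjoint-⊆ʳ proj₁ bc∩S) (Disjoint-⁅⁆ a∉S′)
    bcaS′∩T : Disjoint (⁅ b ⁆ ∪ ⁅ c ⁆ ∪ ⁅ a ⁆ ∪ S′) T
    bcaS′∩T = Disjoint-∪ (Disjoint-∪ bc∩T (Disjoint-⁅⁆ a∉T)) (Disjoint-⊆ˡ proj₁ S∩T)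
    bcd∩S : Disjoint (⁅ b ⁆ ∪ ⁅ c ⁆ ∪ ⁅ d ⁆) S
    bcd∩S = Disjoint-∪ bc∩S (Disjoint-⁅⁆ d∉S)
    bcdS∩T′ : Disjoint (⁅ b ⁆ ∪ ⁅ c ⁆ ∪ ⁅ d ⁆ ∪ S) T′
    bcdS∩T′ = Disjoint-∪ (Disjoint-∪ (Disjoint-⊆ʳ proj₁ bc∩T) (Disjoint-⁅⁆ d∉T′)) (Disjoint-⊆ʳ proj₁ S∩T)
    abdc∩S′ : Disjoint (⁅ a ⁆ ∪ ⁅ b ⁆ ∪ (⁅ d ⁆ ∪ ⁅ c ⁆)) S′
    abdc∩S′ = Disjoint-∪ (Disjoint-∪ (Disjoint-⁅⁆ a∉S′) (Disjoint-⊆ʳ proj₁ (Disjoint-⁅⁆ b∉S)))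
                         (Disjoint-⊆ʳ proj₁ (Disjoint-∪ (Disjoint-⁅⁆ d∉S) (Disjoint-⁅⁆ c∉S)))
    abdcS′∩T′ : Disjoint (⁅ a ⁆ ∪ ⁅ b ⁆ ∪ (⁅ d ⁆ ∪ ⁅ c ⁆) ∪ S′) T′
    abdcS′∩T′ = Disjoint-∪ (Disjoint-∪ (Disjoint-⊆ʳ proj₁ (Disjoint-∪ (Disjoint-⁅⁆ a∉T) (Disjoint-⁅⁆ b∉T)))
                                      (Disjoint-∪ (Disjoint-⁅⁆ d∉T′) (Disjoint-⊆ʳ proj₁ (Disjoint-⁅⁆ c∉T))))
                           (Disjoint-⊆ˡ proj₁ (Disjoint-⊆ʳ proj₁ S∩T))

    Fab∪dc : StarForest (Eab ∪ᴳ Edc) (⁅ a ⁆ ∪ ⁅ b ⁆ ∪ (⁅ d ⁆ ∪ ⁅ c ⁆))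
    Fab∪dc = starForest-∪ (edgeGraph-starForest eab) (edgeGraph-starForest (edge-sym G ecd)) ab∩dc

    F₁ᵢ : StarForest (Ebc ∪ᴳ HS) (⁅ b ⁆ ∪ ⁅ c ⁆ ∪ S)
    F₁ᵢ = starForest-∪ Fbc FS bc∩S
    F₂ᵢ : StarForest (Eab ∪ᴳ Ebc ∪ᴳ HS′) (⁅ b ⁆ ∪ ⁅ c ⁆ ∪ ⁅ a ⁆ ∪ S′)
    F₂ᵢ = starForest-∪ Fabc FS′ bca∩S′
    F₃ᵢ : StarForest (Edc ∪ᴳ Ebc ∪ᴳ HS) (⁅ b ⁆ ∪ ⁅ c ⁆ ∪ ⁅ d ⁆ ∪ S)
    F₃ᵢ = starForest-∪ Fdcb FS bcd∩S
    F₄ᵢ : StarForest (Eab ∪ᴳ Edc ∪ᴳ HS′) (⁅ a ⁆ ∪ ⁅ b ⁆ ∪ (⁅ d ⁆ ∪ ⁅ c ⁆) ∪ S′)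
    F₄ᵢ = starForest-∪ Fab∪dc FS′ abdc∩S′

    covers₁ : ∀ u → (⁅ b ⁆ ∪ ⁅ c ⁆ ∪ S ∪ T) u
    covers₁ u with S? u | u ≟F b | u ≟F c
    ... | yes su | _ | _ = inj₁ (inj₂ su)
    ... | no _ | yes u≡b | _ = inj₁ (inj₁ (inj₁ u≡b))
    ... | no _ | no _ | yes u≡c = inj₁ (inj₁ (inj₂ u≡c))
    ... | no u∉S | no u≢b | no u≢c = inj₂ (u∉S , u≢b , u≢c)

    covers₂ : ∀ u → (⁅ b ⁆ ∪ ⁅ c ⁆ ∪ ⁅ a ⁆ ∪ S′ ∪ T) u
    covers₂ u with S? u | u ≟F a | u ≟F b | u ≟F c
    ... | yes _ | yes u≡a | _ | _ = inj₁ (inj₁ (inj₂ u≡a))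
    ... | yes su | no u≢a | _ | _ = inj₁ (inj₂ (su , u≢a))
    ... | no _ | _ | yes u≡b | _ = inj₁ (inj₁ (inj₁ (inj₁ u≡b)))
    ... | no _ | _ | no _ | yes u≡c = inj₁ (inj₁ (inj₁ (inj₂ u≡c)))
    ... | no u∉S | _ | no u≢b | no u≢c = inj₂ (u∉S , u≢b , u≢c)

    covers₃ : ∀ u → (⁅ b ⁆ ∪ ⁅ c ⁆ ∪ ⁅ d ⁆ ∪ S ∪ T′) u
    covers₃ u with S? u | u ≟F b | u ≟F c | u ≟F d
    ... | yes su | _ | _ | _ = inj₁ (inj₂ su)
    ... | no _ | yes u≡b | _ | _ = inj₁ (inj₁ (inj₁ (inj₁ u≡b)))
    ... | no _ | no _ | yes u≡c | _ = inj₁ (inj₁ (inj₁ (inj₂ u≡c)))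
    ... | no _ | no _ | no _ | yes u≡d = inj₁ (inj₁ (inj₂ u≡d))
    ... | no u∉S | no u≢b | no u≢c | no u≢d = inj₂ ((u∉S , u≢b , u≢c) , u≢d)

    covers₄ : ∀ u → (⁅ a ⁆ ∪ ⁅ b ⁆ ∪ (⁅ d ⁆ ∪ ⁅ c ⁆) ∪ S′ ∪ T′) u
    covers₄ u with S? u | u ≟F a | u ≟F b | u ≟F c | u ≟F d
    ... | yes _ | yes u≡a | _ | _ | _ = inj₁ (inj₁ (inj₁ (inj₁ u≡a)))
    ... | yes su | no u≢a | _ | _ | _ = inj₁ (inj₂ (su , u≢a))
    ... | no _ | _ | yes u≡b | _ | _ = inj₁ (inj₁ (inj₁ (inj₂ u≡b)))
    ... | no _ | _ | no _ | yes u≡c | _ = inj₁ (inj₁ (inj₂ (inj₂ u≡c)))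
    ... | no _ | _ | no _ | no _ | yes u≡d = inj₁ (inj₁ (inj₂ (inj₁ u≡d)))
    ... | no u∉S | _ | no u≢b | no u≢c | no u≢d = inj₂ ((u∉S , u≢b , u≢c) , u≢d)

    factor₁ : IsStarFactor G H₁
    factor₁ = starForest⇒starFactor (starForest-∪ F₁ᵢ FT bcS∩T) covers₁
    factor₂ : IsStarFactor G H₂
    factor₂ = starForest⇒starFactor (starForest-∪ F₂ᵢ FT bcaS′∩T) covers₂
    factor₃ : IsStarFactor G H₃
    factor₃ = starForest⇒starFactor (starForest-∪ F₃ᵢ FT′ bcdS∩T′) covers₃
    factor₄ : IsStarFactor G H₄
    factor₄ = starForest⇒starFactor (starForest-∪ F₄ᵢ FT′ abdcS′∩T′) covers₄

    weight₁ : W H₁ ≡ W Ebc + W HS + W HT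
    weight₁ = trans (weight-∪-starForests w F₁ᵢ FT bcS∩T) (cong (_+ W HT) (weight-∪-starForests w Fbc FS bc∩S))

    weight₂ : W H₂ ≡ W Eab + W Ebc + W HS′ + W HT
    weight₂ = trans (weight-∪-starForests w F₂ᵢ FT bcaS′∩T)
                    (cong (_+ W HT) (trans (weight-∪-starForests w Fabc FS′ bca∩S′)
                                           (cong (_+ W HS′) (weight-attach w Fbc a∉bc))))

    weight₃ : W H₃ ≡ W Edc + W Ebc + W HS + W HT′
    weight₃ = trans (weight-∪-starForests w F₃ᵢ FT′ bcdS∩T′)
                    (cong (_+ W HT′) (trans (weight-∪-starForests w Fdcb FS bcd∩S)
                                            (cong (_+ W HS) (weight-attach w Fbc d∉bc))))

    weight₄ : W H₄ ≡ W Eab + W Edc + W HS′ + W HT′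
    weight₄ = trans (weight-∪-starForests w F₄ᵢ FT′ abdcS′∩T′)
                    (cong (_+ W HT′) (trans (weight-∪-starForests w Fab∪dc FS′ abdc∩S′)
                                            (cong (_+ W HS′) (weight-∪-starForests w (edgeGraph-starForest eab)
                                                                (edgeGraph-starForest (edge-sym G ecd)) ab∩dc))))

    exchange : W H₁ + W H₄ + W Ebc ≡ W H₂ + W H₃
    exchange = trans (cong₂ (λ p q → p + q + W Ebc) weight₁ weight₄)
                     (trans (identity (W Eab) (W Ebc) (W Edc) (W HS) (W HS′) (W HT) (W HT′))
                            (sym (cong₂ _+_ weight₂ weight₃)))
      where
      identity : ∀ ab bc dc s s′ t t′ → bc + s + t + (ab + dc + s′ + t′) + bc ≡ ab + bc + s′ + t + (dc + bc + s + t′)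
      identity = solve-∀

    contradiction : ⊥
    contradiction = edgeWeight≢0 ebc (equalWeights⇒zero {H₁} {H₄} {H₂} {H₃} factor₁ factor₄ factor₂ factor₃ exchange)

  module BranchingNextToStem {c x y s : Fin n} (rc : Remaining G c) (rx : Remaining G x) (ry : Remaining G y)
                             (exc : Edge G x c) (eyc : Edge G y c) (x≢y : x ≢ y) (ecs : Edge G c s) (stem : IsStem G s)
                             (Sx? : ∀ u → Dec (Reach (Avoiding c) x u)) (Sy? : ∀ u → Dec (Reach (Avoiding c) y u)) where
    module X = Branch rc rx exc Sx?
    module Y = Branch rc ry eyc Sy?
    open X using () renaming (B to Sx; B′ to Sx′; z∉B to c∉Sx; x∉B′ to x∉Sx′; HB to HSx; HB′ to HSx′; FB to FSx; FB′ to FSx′)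
    open Y using () renaming (B to Sy; B′ to Sy′; z∉B to c∉Sy; x∉B′ to y∉Sy′; HB to HSy; HB′ to HSy′; FB to FSy; FB′ to FSy′)

    ℓ : Fin n
    ℓ = proj₁ stem
    esℓ : Edge G s ℓ
    esℓ = proj₁ (proj₂ stem)
    leaf : IsLeaf G ℓ
    leaf = proj₂ (proj₂ stem)

    ≢s : ∀ {u} → Remaining G u → u ≢ s
    ≢s ru refl = proj₂ ru stem

    s≢c : s ≢ c
    s≢c = ≢-sym (edge⇒≢ G ecs)

    Sx∩Sy : Disjoint Sx Sy
    Sx∩Sy u sx sy = Y.neighbour∉B x≢y (edge-sym G exc) (Reach-trans sy (Reach-sym Avoiding-sym sx))

    s∉Sx : ¬ Sx s
    s∉Sx = X.neighbour∉B (≢-sym (≢s rx)) ecs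
    s∉Sy : ¬ Sy s
    s∉Sy = Y.neighbour∉B (≢-sym (≢s ry)) ecs
    y∉Sx : ¬ Sx y
    y∉Sx = X.neighbour∉B (≢-sym x≢y) (edge-sym G eyc)
    x∉Sy : ¬ Sy x
    x∉Sy = Y.neighbour∉B x≢y (edge-sym G exc)

    -- Sx and Sy are the branches of G − c containing x and y, and R the rest of G − c.
    R : Fin n → Set
    R u = ¬ Sx u × ¬ Sy u × u ≢ c

    R? : ∀ u → Dec (R u)
    R? u = ¬? (Sx? u) ×-dec (¬? (Sy? u) ×-dec ¬? (u ≟F c))

    R-covered : ∀ u → R u → Σ (Fin n) λ t → Edge G u t × R t
    R-covered u (u∉Sx , u∉Sy , u≢c) with escape {x₀ = c} (_≟F c) u≢c (λ { refl → here , rc })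
    ... | t , eut , t≢c = t , eut , (λ sx → u∉Sx (X.B-closed sx (edge-sym G eut) u≢c)) ,
                                    (λ sy → u∉Sy (Y.B-closed sy (edge-sym G eut) u≢c)) , t≢c

    HR : Graph n
    HR = proj₁ (starForest-exists R? R-covered)

    FR : StarForest HR R
    FR = proj₂ (starForest-exists R? R-covered)

    s∈R : R s
    s∈R = s∉Sx , s∉Sy , s≢c

    ℓ∈R : R ℓ
    ℓ∈R = (λ sx → s∉Sx (X.B-closed sx (edge-sym G esℓ) s≢c)) , (λ sy → s∉Sy (Y.B-closed sy (edge-sym G esℓ) s≢c)) ,
          (λ { refl → proj₁ rc leaf })

    c∉R : ¬ R c
    c∉R (_ , _ , c≢c) = c≢c refl
    x∉R : ¬ R x
    x∉R (x∉Sx , _) = x∉Sx here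
    y∉R : ¬ R y
    y∉R (_ , y∉Sy , _) = y∉Sy here
    x∉cy : ¬ (⁅ c ⁆ ∪ ⁅ y ⁆) x
    x∉cy (inj₁ x≡c) = edge⇒≢ G exc x≡c
    x∉cy (inj₂ x≡y) = x≢y x≡y

    Sx∩R : Disjoint Sx R
    Sx∩R u sx (u∉Sx , _) = u∉Sx sx
    Sy∩R : Disjoint Sy R
    Sy∩R u sy (_ , u∉Sy , _) = u∉Sy sy

    Ecs Exc Ecy : Graph n
    Ecs = edgeGraph c s
    Exc = edgeGraph x c
    Ecy = edgeGraph c y

    H₁ H₂ H₃ H₄ : Graph n
    H₁ = Ecs ∪ᴳ HR ∪ᴳ HSx ∪ᴳ HSy
    H₂ = Exc ∪ᴳ HSx′ ∪ᴳ HSy ∪ᴳ HR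
    H₃ = Exc ∪ᴳ Ecy ∪ᴳ HSx′ ∪ᴳ HSy′ ∪ᴳ HR
    H₄ = Ecy ∪ᴳ HSx ∪ᴳ HSy′ ∪ᴳ HR

    FRc : StarForest (Ecs ∪ᴳ HR) (R ∪ ⁅ c ⁆)
    FRc = starForest-attach FR c∉R s∈R ecs (starForest-stemHub FR ℓ∈R leaf esℓ)

    Fxc : StarForest Exc (⁅ x ⁆ ∪ ⁅ c ⁆)
    Fxc = edgeGraph-starForest exc

    Fcy : StarForest Ecy (⁅ c ⁆ ∪ ⁅ y ⁆)
    Fcy = edgeGraph-starForest (edge-sym G eyc)

    Fcyx : StarForest (Exc ∪ᴳ Ecy) (⁅ c ⁆ ∪ ⁅ y ⁆ ∪ ⁅ x ⁆)
    Fcyx = starForest-attach Fcy x∉cy (inj₁ refl) exc (edgeGraph-hubˡ (edge-sym G eyc))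

    Rc∩Sx : Disjoint (R ∪ ⁅ c ⁆) Sx
    Rc∩Sx = Disjoint-∪ (λ u r sx → Sx∩R u sx r) (Disjoint-⁅⁆ c∉Sx)
    RcSx∩Sy : Disjoint (R ∪ ⁅ c ⁆ ∪ Sx) Sy
    RcSx∩Sy = Disjoint-∪ (Disjoint-∪ (λ u r sy → Sy∩R u sy r) (Disjoint-⁅⁆ c∉Sy)) Sx∩Sy
    xc∩Sx′ : Disjoint (⁅ x ⁆ ∪ ⁅ c ⁆) Sx′
    xc∩Sx′ = Disjoint-∪ (Disjoint-⁅⁆ x∉Sx′) (Disjoint-⊆ʳ proj₁ (Disjoint-⁅⁆ c∉Sx))
    xcSx′∩Sy : Disjoint (⁅ x ⁆ ∪ ⁅ c ⁆ ∪ Sx′) Sy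
    xcSx′∩Sy = Disjoint-∪ (Disjoint-∪ (Disjoint-⁅⁆ x∉Sy) (Disjoint-⁅⁆ c∉Sy)) (Disjoint-⊆ˡ proj₁ Sx∩Sy)
    xcSx′Sy∩R : Disjoint (⁅ x ⁆ ∪ ⁅ c ⁆ ∪ Sx′ ∪ Sy) R
    xcSx′Sy∩R = Disjoint-∪ (Disjoint-∪ (Disjoint-∪ (Disjoint-⁅⁆ x∉R) (Disjoint-⁅⁆ c∉R)) (Disjoint-⊆ˡ proj₁ Sx∩R)) Sy∩R
    cyx∩Sx′ : Disjoint (⁅ c ⁆ ∪ ⁅ y ⁆ ∪ ⁅ x ⁆) Sx′
    cyx∩Sx′ = Disjoint-∪ (Disjoint-⊆ʳ proj₁ (Disjoint-∪ (Disjoint-⁅⁆ c∉Sx) (Disjoint-⁅⁆ y∉Sx))) (Disjoint-⁅⁆ x∉Sx′)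
    cyxSx′∩Sy′ : Disjoint (⁅ c ⁆ ∪ ⁅ y ⁆ ∪ ⁅ x ⁆ ∪ Sx′) Sy′
    cyxSx′∩Sy′ = Disjoint-∪ (Disjoint-∪ (Disjoint-∪ (Disjoint-⊆ʳ proj₁ (Disjoint-⁅⁆ c∉Sy)) (Disjoint-⁅⁆ y∉Sy′))
                                      (Disjoint-⊆ʳ proj₁ (Disjoint-⁅⁆ x∉Sy)))
                           (Disjoint-⊆ˡ proj₁ (Disjoint-⊆ʳ proj₁ Sx∩Sy))
    cyxSx′Sy′∩R : Disjoint (⁅ c ⁆ ∪ ⁅ y ⁆ ∪ ⁅ x ⁆ ∪ Sx′ ∪ Sy′) R
    cyxSx′Sy′∩R = Disjoint-∪ (Disjoint-∪ (Disjoint-∪ (Disjoint-∪ (Disjoint-⁅⁆ c∉R) (Disjoint-⁅⁆ y∉R)) (Disjoint-⁅⁆ x∉R))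
                                        (Disjoint-⊆ˡ proj₁ Sx∩R))
                            (Disjoint-⊆ˡ proj₁ Sy∩R)
    cy∩Sx : Disjoint (⁅ c ⁆ ∪ ⁅ y ⁆) Sx
    cy∩Sx = Disjoint-∪ (Disjoint-⁅⁆ c∉Sx) (Disjoint-⁅⁆ y∉Sx)
    cySx∩Sy′ : Disjoint (⁅ c ⁆ ∪ ⁅ y ⁆ ∪ Sx) Sy′
    cySx∩Sy′ = Disjoint-∪ (Disjoint-∪ (Disjoint-⊆ʳ proj₁ (Disjoint-⁅⁆ c∉Sy)) (Disjoint-⁅⁆ y∉Sy′)) (Disjoint-⊆ʳ proj₁ Sx∩Sy)
    cySxSy′∩R : Disjoint (⁅ c ⁆ ∪ ⁅ y ⁆ ∪ Sx ∪ Sy′) R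
    cySxSy′∩R = Disjoint-∪ (Disjoint-∪ (Disjoint-∪ (Disjoint-⁅⁆ c∉R) (Disjoint-⁅⁆ y∉R)) Sx∩R) (Disjoint-⊆ˡ proj₁ Sy∩R)

    F₁ᵢ : StarForest (Ecs ∪ᴳ HR ∪ᴳ HSx) (R ∪ ⁅ c ⁆ ∪ Sx)
    F₁ᵢ = starForest-∪ FRc FSx Rc∩Sx
    F₂ₐ : StarForest (Exc ∪ᴳ HSx′) (⁅ x ⁆ ∪ ⁅ c ⁆ ∪ Sx′)
    F₂ₐ = starForest-∪ Fxc FSx′ xc∩Sx′
    F₂ᵢ : StarForest (Exc ∪ᴳ HSx′ ∪ᴳ HSy) (⁅ x ⁆ ∪ ⁅ c ⁆ ∪ Sx′ ∪ Sy)
    F₂ᵢ = starForest-∪ F₂ₐ FSy xcSx′∩Sy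
    F₃ₐ : StarForest (Exc ∪ᴳ Ecy ∪ᴳ HSx′) (⁅ c ⁆ ∪ ⁅ y ⁆ ∪ ⁅ x ⁆ ∪ Sx′)
    F₃ₐ = starForest-∪ Fcyx FSx′ cyx∩Sx′
    F₃ᵢ : StarForest (Exc ∪ᴳ Ecy ∪ᴳ HSx′ ∪ᴳ HSy′) (⁅ c ⁆ ∪ ⁅ y ⁆ ∪ ⁅ x ⁆ ∪ Sx′ ∪ Sy′)
    F₃ᵢ = starForest-∪ F₃ₐ FSy′ cyxSx′∩Sy′
    F₄ₐ : StarForest (Ecy ∪ᴳ HSx) (⁅ c ⁆ ∪ ⁅ y ⁆ ∪ Sx)
    F₄ₐ = starForest-∪ Fcy FSx cy∩Sx
    F₄ᵢ : StarForest (Ecy ∪ᴳ HSx ∪ᴳ HSy′) (⁅ c ⁆ ∪ ⁅ y ⁆ ∪ Sx ∪ Sy′)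
    F₄ᵢ = starForest-∪ F₄ₐ FSy′ cySx∩Sy′

    covers₁ : ∀ u → (R ∪ ⁅ c ⁆ ∪ Sx ∪ Sy) u
    covers₁ u with Sx? u | Sy? u | u ≟F c
    ... | yes sx | _ | _ = inj₁ (inj₂ sx)
    ... | no _ | yes sy | _ = inj₂ sy
    ... | no _ | no _ | yes u≡c = inj₁ (inj₁ (inj₂ u≡c))
    ... | no u∉Sx | no u∉Sy | no u≢c = inj₁ (inj₁ (inj₁ (u∉Sx , u∉Sy , u≢c)))

    covers₂ : ∀ u → (⁅ x ⁆ ∪ ⁅ c ⁆ ∪ Sx′ ∪ Sy ∪ R) u
    covers₂ u with Sx? u | Sy? u | u ≟F c | u ≟F x
    ... | yes _ | _ | _ | yes u≡x = inj₁ (inj₁ (inj₁ (inj₁ u≡x)))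
    ... | yes sx | _ | _ | no u≢x = inj₁ (inj₁ (inj₂ (sx , u≢x)))
    ... | no _ | yes sy | _ | _ = inj₁ (inj₂ sy)
    ... | no _ | no _ | yes u≡c | _ = inj₁ (inj₁ (inj₁ (inj₂ u≡c)))
    ... | no u∉Sx | no u∉Sy | no u≢c | _ = inj₂ (u∉Sx , u∉Sy , u≢c)

    covers₃ : ∀ u → (⁅ c ⁆ ∪ ⁅ y ⁆ ∪ ⁅ x ⁆ ∪ Sx′ ∪ Sy′ ∪ R) u
    covers₃ u with Sx? u | Sy? u | u ≟F c | u ≟F x | u ≟F y
    ... | yes _ | _ | _ | yes u≡x | _ = inj₁ (inj₁ (inj₁ (inj₂ u≡x)))
    ... | yes sx | _ | _ | no u≢x | _ = inj₁ (inj₁ (inj₂ (sx , u≢x)))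
    ... | no _ | yes _ | _ | _ | yes u≡y = inj₁ (inj₁ (inj₁ (inj₁ (inj₂ u≡y))))
    ... | no _ | yes sy | _ | _ | no u≢y = inj₁ (inj₂ (sy , u≢y))
    ... | no _ | no _ | yes u≡c | _ | _ = inj₁ (inj₁ (inj₁ (inj₁ (inj₁ u≡c))))
    ... | no u∉Sx | no u∉Sy | no u≢c | _ | _ = inj₂ (u∉Sx , u∉Sy , u≢c)

    covers₄ : ∀ u → (⁅ c ⁆ ∪ ⁅ y ⁆ ∪ Sx ∪ Sy′ ∪ R) u
    covers₄ u with Sx? u | Sy? u | u ≟F c | u ≟F y
    ... | yes sx | _ | _ | _ = inj₁ (inj₁ (inj₂ sx))
    ... | no _ | yes _ | _ | yes u≡y = inj₁ (inj₁ (inj₁ (inj₂ u≡y)))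
    ... | no _ | yes sy | _ | no u≢y = inj₁ (inj₂ (sy , u≢y))
    ... | no _ | no _ | yes u≡c | _ = inj₁ (inj₁ (inj₁ (inj₁ u≡c)))
    ... | no u∉Sx | no u∉Sy | no u≢c | _ = inj₂ (u∉Sx , u∉Sy , u≢c)

    factor₁ : IsStarFactor G H₁
    factor₁ = starForest⇒starFactor (starForest-∪ F₁ᵢ FSy RcSx∩Sy) covers₁
    factor₂ : IsStarFactor G H₂
    factor₂ = starForest⇒starFactor (starForest-∪ F₂ᵢ FR xcSx′Sy∩R) covers₂
    factor₃ : IsStarFactor G H₃
    factor₃ = starForest⇒starFactor (starForest-∪ F₃ᵢ FR cyxSx′Sy′∩R) covers₃
    factor₄ : IsStarFactor G H₄
    factor₄ = starForest⇒starFactor (starForest-∪ F₄ᵢ FR cySxSy′∩R) covers₄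

    weight₁ : W H₁ ≡ W Ecs + W HR + W HSx + W HSy
    weight₁ = trans (weight-∪-starForests w F₁ᵢ FSy RcSx∩Sy)
              (cong (_+ W HSy) (trans (weight-∪-starForests w FRc FSx Rc∩Sx)
                                      (cong (_+ W HSx) (weight-attach w FR c∉R))))

    weight₂ : W H₂ ≡ W Exc + W HSx′ + W HSy + W HR
    weight₂ = trans (weight-∪-starForests w F₂ᵢ FR xcSx′Sy∩R)
              (cong (_+ W HR) (trans (weight-∪-starForests w F₂ₐ FSy xcSx′∩Sy)
                                     (cong (_+ W HSy) (weight-∪-starForests w Fxc FSx′ xc∩Sx′))))

    weight₃ : W H₃ ≡ W Exc + W Ecy + W HSx′ + W HSy′ + W HR
    weight₃ = trans (weight-∪-starForests w F₃ᵢ FR cyxSx′Sy′∩R)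
              (cong (_+ W HR) (trans (weight-∪-starForests w F₃ₐ FSy′ cyxSx′∩Sy′)
                              (cong (_+ W HSy′) (trans (weight-∪-starForests w Fcyx FSx′ cyx∩Sx′)
                                                (cong (_+ W HSx′) (weight-attach w Fcy x∉cy))))))

    weight₄ : W H₄ ≡ W Ecy + W HSx + W HSy′ + W HR
    weight₄ = trans (weight-∪-starForests w F₄ᵢ FR cySxSy′∩R)
              (cong (_+ W HR) (trans (weight-∪-starForests w F₄ₐ FSy′ cySx∩Sy′)
                                     (cong (_+ W HSy′) (weight-∪-starForests w Fcy FSx cy∩Sx))))

    exchange : W H₂ + W H₄ + W Ecs ≡ W H₁ + W H₃
    exchange = trans (cong₂ (λ p q → p + q + W Ecs) weight₂ weight₄)
                     (trans (identity (W Ecs) (W Exc) (W Ecy) (W HR) (W HSx) (W HSx′) (W HSy) (W HSy′))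
                            (sym (cong₂ _+_ weight₁ weight₃)))
      where
      identity : ∀ cs xc cy r sx sx′ sy sy′ →
                 xc + sx′ + sy + r + (cy + sx + sy′ + r) + cs ≡ cs + r + sx + sy + (xc + cy + sx′ + sy′ + r)
      identity = solve-∀

    contradiction : ⊥
    contradiction = edgeWeight≢0 ecs (equalWeights⇒zero {H₂} {H₄} {H₁} {H₃} factor₂ factor₄ factor₁ factor₃ exchange)

  -- The branches are only decided inside proofs of ⊥, where ¬¬-decidable makes them decidable.
  noRemainingPath : ∀ {a b c d} → EdgeRem G a b → EdgeRem G b c → EdgeRem G c d → a ≢ c → b ≢ d → ⊥
  noRemainingPath (ra , rb , eab) (_ , rc , ebc) (_ , rd , ecd) a≢c b≢d =
    ¬¬-decidable _ (RemainingPath.contradiction ra rb rc rd eab ebc ecd a≢c b≢d)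

  noBranchingNextToStem : ∀ {c x y s} → EdgeRem G c x → EdgeRem G c y → x ≢ y → Edge G c s → IsStem G s → ⊥
  noBranchingNextToStem (rc , rx , ecx) (_ , ry , ecy) x≢y ecs stem =
    ¬¬-decidable _ λ Sx? → ¬¬-decidable _ λ Sy? →
      BranchingNextToStem.contradiction rc rx ry (edge-sym G ecx) (edge-sym G ecy) x≢y ecs stem Sx? Sy?

  open StarAround (EdgeRem G) EdgeRem? EdgeRem-sym EdgeRem-irrefl

  twoRemainingNeighbours⇒hub : ∀ {c} → 2 ≤ count (remainingNeighbours c) → IsHub c
  twoRemainingNeighbours⇒hub {c} 2≤ x y ecx exy with twoRemainingNeighbours 2≤ | y ≟F c
  ... | _ | yes y≡c = y≡c
  ... | x₁ , x₂ , ecx₁ , ecx₂ , x₁≢x₂ | no y≢c with x₁ ≟F x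
  ...   | yes refl = ⊥-elim (noRemainingPath (EdgeRem-sym exy) (EdgeRem-sym ecx) ecx₂ y≢c x₁≢x₂)
  ...   | no x₁≢x = ⊥-elim (noRemainingPath (EdgeRem-sym exy) (EdgeRem-sym ecx) ecx₁ y≢c (≢-sym x₁≢x))

  lowDegreeNeighbours⇒hub : ∀ {c} → (∀ x → EdgeRem G c x → ¬ 2 ≤ count (remainingNeighbours x)) → IsHub c
  lowDegreeNeighbours⇒hub {c} low x y ecx exy with y ≟F c
  ... | yes y≡c = y≡c
  ... | no y≢c = ⊥-elim (low x ecx (2≤count y c (dec-true (EdgeRem? x y) exy) (dec-true (EdgeRem? x c) (EdgeRem-sym ecx)) y≢c))

  centreDegree : ∀ {c} → Remaining G c → 2 ≤ count (remainingNeighbours c) → deg G c ≡ count (remainingNeighbours c)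
  centreDegree {c} rc 2≤ = trans (deg≡count c) (count-cong neighbour⇔remainingNeighbour)
    where
    neighbour⇒remaining : ∀ {u} → Edge G c u → Remaining G u
    neighbour⇒remaining {u} ecu with Leaf? u | Stem? u
    ... | yes leaf | _ = ⊥-elim (proj₂ rc (u , ecu , leaf))
    ... | no _ | yes stem with twoRemainingNeighbours 2≤
    ...   | _ , _ , ecx₁ , ecx₂ , x₁≢x₂ = ⊥-elim (noBranchingNextToStem ecx₁ ecx₂ x₁≢x₂ ecu stem)
    neighbour⇒remaining {u} ecu | no ¬leaf | no ¬stem = ¬leaf , ¬stem
    neighbour⇔remainingNeighbour : ∀ u → adj G c u ≡ remainingNeighbours c u
    neighbour⇔remainingNeighbour u = agree (Edge? G c u)
      where
      agree : Dec (Edge G c u) → adj G c u ≡ remainingNeighbours c u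
      agree (yes ecu) = trans ecu (sym (dec-true (EdgeRem? c u) (rc , neighbour⇒remaining ecu , ecu)))
      agree (no ¬ecu) = trans (¬-not ¬ecu) (sym (dec-false (EdgeRem? c u) (λ e → ¬ecu (proj₂ (proj₂ e)))))

  hubComponent : ∀ {c v} → Remaining G c → IsHub c → InStar c v →
                 Σ ℕ λ m → Σ (Fin (suc m) → Fin n) λ f →
                   IsStarK1 (EdgeRem G) (Reach (EdgeRem G) v) m f × (2 ≤ m → deg G (f zero) ≡ m)
  hubComponent {c} rc hub v∈ = count (neighbours c) , star c , star-isStar hub v∈ , centreDegree rc

  remainderCondition : RemainderCondition G
  remainderCondition v rv with 2 ≤? count (remainingNeighbours v)
  ... | yes 2≤ = hubComponent rv (twoRemainingNeighbours⇒hub 2≤) (inj₁ refl)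
  ... | no _ with any? (λ u → EdgeRem? v u ×-dec (2 ≤? count (remainingNeighbours u)))
  ...   | yes (u , evu , 2≤) = hubComponent (proj₁ (proj₂ evu)) (twoRemainingNeighbours⇒hub 2≤) (inj₂ (EdgeRem-sym evu))
  ...   | no ¬centreNeighbour =
    hubComponent rv (lowDegreeNeighbours⇒hub (λ x evx 2≤ → ¬centreNeighbour (x , evx , 2≤))) (inj₁ refl)

corollary2p2 : ∀ (n : ℕ) (G : Graph n) → IsTree G →
    (InΩ G ⇔ RemainderCondition G)
corollary2p2 n G tree = mk⇔ (Forward.remainderCondition G tree) (TipWeighting.inΩ G)
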